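{- Let $D$ be a disconnected finite poset with $|D|=n$, let $P,Q$ be finite posets with $|P|=p$, $|Q|=q$, and let $R=P\oplus D\oplus Q$. If $R$ is LE-cactus, then: if $n>3$, one of the following holds: (1) $p>q+n-4$; (2) $p=q+n-4$ and $q\bmod n\notin\{1,3\}$; (3) $p=q+n-r$ for some integer $r>4$ and $q\bmod n>r-1$; and if $n=3$, one of the following holds: (1) $p>q-1$; (2) $p=q-1$ and $q\bmod 3\notin\{1,3\}$.
   Context: For a finite poset $X$ with $|X|=N$, a linear extension is a bijection $f:X\to\{1,\ldots,N\}$ with $f(a)<f(b)$ whenever $a<_X b$. For $1\le i\le N-1$ the Bender–Knuth involution $t_i$ swaps labels $i$ and $i+1$ of a linear extension if $f^{ -1}(i)$, $f^{ -1}(i+1)$ are incomparable, and does nothing otherwise. Products denote composition, rightmost first. $q_0=\mathrm{id}$, $q_i=t_1(t_2t_1)\cdots(t_it_{i-1}\cdots t_1)$, $q_{jk}=q_{k-1}q_{k-j}q_{k-1}$. $X$ is LE-cactus if $(t_iq_{jk})^2$ is the identity on linear extensions of $X$ for all $1\le i$, $i+1<j<k\le |X|$. $X\oplus Y$ is the ordinal sum (all of $X$ below all of $Y$). Convention: $a\bmod n$ denotes the representative in $\{1,\ldots,n\}$. -}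

module Defs where

open import Level using (0ℓ)
open import Data.Nat using (ℕ; zero; suc; _+_; _∸_; _<_; _≤_; _<?_)
open import Data.Nat.Properties using (<-trans; n<1+n)
open import Data.Nat.DivMod using (_%_)
open import Data.Fin as F using (Fin; fromℕ<; splitAt)
open import Data.Fin.Permutation.Components using (transpose)
open import Data.Sum using (_⊎_; inj₁; inj₂)
open import Data.Product using (_×_)
open import Data.Unit using (⊤)
open import Data.Empty using (⊥)
open import Function using (_∘_; id)
open import Function.Definitions using (Bijective)
open import Relation.Binary using (Rel; Decidable)
open import Relation.Binary.PropositionalEquality using (_≡_)
open import Relation.Binary.Construct.Closure.ReflexiveTransitive using (Star)
open import Relation.Nullary using (¬_; yes; no; Dec)
open import Data.Sum using () renaming (map to ⊎-map)

-- Finite posets are modelled on carrier Fin N by a strict order relation.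

-- a mod n, with representative in {1,…,n} (the n = 0 case is irrelevant)
mod1 : ℕ → ℕ → ℕ
mod1 a zero = zero
mod1 a (suc m) with a % suc m
... | zero  = suc m
... | suc r = suc r

ordRel' : ∀ {m k} → Rel (Fin m) 0ℓ → Rel (Fin k) 0ℓ → Fin m ⊎ Fin k → Fin m ⊎ Fin k → Set
ordRel' R S (inj₁ a) (inj₁ b) = R a b
ordRel' R S (inj₁ a) (inj₂ b) = ⊤
ordRel' R S (inj₂ a) (inj₁ b) = ⊥
ordRel' R S (inj₂ a) (inj₂ b) = S a b

ordRel : ∀ {m k} → Rel (Fin m) 0ℓ → Rel (Fin k) 0ℓ → Rel (Fin (m + k)) 0ℓ
ordRel {m} R S x y = ordRel' R S (splitAt m x) (splitAt m y)

ordDec' : ∀ {m k} (R : Rel (Fin m) 0ℓ) (S : Rel (Fin k) 0ℓ) → Decidable R → Decidable S →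
          (u v : Fin m ⊎ Fin k) → Dec (ordRel' R S u v)
ordDec' R S dR dS (inj₁ a) (inj₁ b) = dR a b
ordDec' R S dR dS (inj₁ a) (inj₂ b) = yes Data.Unit.tt
ordDec' R S dR dS (inj₂ a) (inj₁ b) = no (λ ())
ordDec' R S dR dS (inj₂ a) (inj₂ b) = dS a b

ordDec : ∀ {m k} {R : Rel (Fin m) 0ℓ} {S : Rel (Fin k) 0ℓ} → Decidable R → Decidable S →
         Decidable (ordRel R S)
ordDec {m} {R = R} {S} dR dS x y = ordDec' R S dR dS (splitAt m x) (splitAt m y)

Comparable : ∀ {n} → Rel (Fin n) 0ℓ → Rel (Fin n) 0ℓ
Comparable _≺_ x y = x ≺ y ⊎ y ≺ x

Connected : ∀ {n} → Rel (Fin n) 0ℓ → Set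
Connected _≺_ = ∀ x y → Star (Comparable _≺_) x y

Disconnected : ∀ {n} → Rel (Fin n) 0ℓ → Set
Disconnected _≺_ = ¬ Connected _≺_

-- Linear extensions, recorded in "word" form: w : positions → elements,
-- w = f⁻¹ where f is the labelling; position ℓ (0-based) carries label ℓ+1.
module BK {N : ℕ} (_≺_ : Rel (Fin N) 0ℓ) (_≺?_ : Decidable _≺_) where

  IsLinExt : (Fin N → Fin N) → Set
  IsLinExt w = Bijective _≡_ _≡_ w × (∀ a b → w a ≺ w b → a F.< b)

  step : Fin N → Fin N → (Fin N → Fin N) → Fin N → Fin N
  step a b w with w a ≺? w b | w b ≺? w a
  ... | yes _ | _     = w
  ... | no _  | yes _ = w
  ... | no _  | no _  = w ∘ transpose a b

  -- Bender–Knuth t_i (1 ≤ i ≤ N-1): swaps labels i, i+1 (positions i-1, i)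
  t : ℕ → (Fin N → Fin N) → Fin N → Fin N
  t zero w = w
  t (suc i) w with suc i <? N
  ... | no _   = w
  ... | yes lt = step (fromℕ< (<-trans (n<1+n i) lt)) (fromℕ< lt) w

  chain : ℕ → (Fin N → Fin N) → Fin N → Fin N
  chain zero = id
  chain (suc i) = t (suc i) ∘ chain i

  q : ℕ → (Fin N → Fin N) → Fin N → Fin N
  q zero = id
  q (suc i) = q i ∘ chain (suc i)

  qjk : ℕ → ℕ → (Fin N → Fin N) → Fin N → Fin N
  qjk j k = q (k ∸ 1) ∘ q (k ∸ j) ∘ q (k ∸ 1)

  LECactus : Set
  LECactus = ∀ (i j k : ℕ) → 1 ≤ i → i + 1 < j → j < k → k ≤ N →
             ∀ (w : Fin N → Fin N) → IsLinExt w →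
             ∀ x → (t i ∘ qjk j k) ((t i ∘ qjk j k) w) x ≡ w x

LECactus : ∀ {N} (_≺_ : Rel (Fin N) 0ℓ) → Decidable _≺_ → Set
LECactus R d = BK.LECactus R d

-- Pick minimal elements x₀, y₀ of D in different components and the linear
-- extension listing P, x₀, y₀, the rest of D, Q.  Colour D by component (1 on
-- the component of x₀, 2 elsewhere) and P, Q by 0.  A Bender–Knuth involution
-- only exchanges incomparable neighbours; comparable elements of D share a
-- colour and an uncoloured element is comparable to all of D, so on colour
-- words t_i is the transposition of positions i-1, i when both lie in the
-- window [p, p+n) of D and the identity otherwise.  Hence q_(p+A) acts on the
-- window as z ↦ (A - z) mod n for A ≥ n-1, and for i = p+1, j = A, k = p+A+1
-- with A ≡ 0 or 2 (mod n) the word (t_i q_jk)² w shows at one of the positions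
-- p, p+1 the colour that w has at the other.  These colours differ, so R is not
-- LE-cactus as soon as such an A satisfies p+3 ≤ A and p+A < |R|; if no such A
-- exists, the numerical conditions of the theorem hold.

module Submission where

open import Defs
open import Level using (0ℓ)
open import Data.Empty using (⊥; ⊥-elim)
open import Data.Fin as F using (Fin; zero; suc; toℕ; fromℕ<; _↑ˡ_; _↑ʳ_; splitAt)
open import Data.Fin.Permutation.Components using (transpose)
open import Data.Fin.Properties as FP using (toℕ-fromℕ<; toℕ-injective; any?) renaming (_≟_ to _≟F_)
open import Data.Nat
open import Data.Nat.DivMod
open import Data.Nat.Properties
open import Data.Nat.Tactic.RingSolver using (solve-∀)
open import Data.Product as Product using (_×_; _,_; proj₁; proj₂; ∃-syntax)
open import Data.Sum as Sum using (_⊎_; inj₁; inj₂; [_,_]; swap)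
open import Data.Unit using (⊤; tt)
open import Function using (_∘_; id)
open import Function.Definitions using (Injective; Bijective)
open import Relation.Binary using (Rel; Decidable; IsStrictPartialOrder; tri<; tri≈; tri>)
open import Relation.Binary.Construct.Closure.ReflexiveTransitive using (Star; ε; _◅_; _◅◅_; reverse)
open import Relation.Binary.PropositionalEquality
  using (_≡_; _≢_; refl; sym; trans; cong; cong₂; subst; subst₂; module ≡-Reasoning)
open import Relation.Nullary using (¬_; Dec; yes; no; _×-dec_)
open import Relation.Nullary.Decidable using (¬¬-excluded-middle)
open import Relation.Unary as U using (Pred; _⊆_)

-- Counting over Fin

module _ where
  private variable N : ℕ

  count : {P : Pred (Fin N) 0ℓ} → U.Decidable P → ℕ
  count {zero}  P? = 0
  count {suc N} P? with P? zero
  ... | yes _ = suc (count (P? ∘ suc))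
  ... | no  _ = count (P? ∘ suc)

  count-mono : {P Q : Pred (Fin N) 0ℓ} (P? : U.Decidable P) (Q? : U.Decidable Q) →
               P ⊆ Q → count P? ≤ count Q?
  count-mono {zero}  P? Q? P⊆Q = z≤n
  count-mono {suc N} P? Q? P⊆Q with P? zero | Q? zero
  ... | yes P0 | no ¬Q0 = ⊥-elim (¬Q0 (P⊆Q P0))
  ... | yes _  | yes _  = s≤s (count-mono (P? ∘ suc) (Q? ∘ suc) P⊆Q)
  ... | no _   | yes _  = m≤n⇒m≤1+n (count-mono (P? ∘ suc) (Q? ∘ suc) P⊆Q)
  ... | no _   | no _   = count-mono (P? ∘ suc) (Q? ∘ suc) P⊆Q

  count-mono-< : {P Q : Pred (Fin N) 0ℓ} (P? : U.Decidable P) (Q? : U.Decidable Q) →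
                 P ⊆ Q → ∀ x → ¬ P x → Q x → count P? < count Q?
  count-mono-< P? Q? P⊆Q zero ¬Px Qx with P? zero | Q? zero
  ... | yes Px | _      = ⊥-elim (¬Px Px)
  ... | no _   | no ¬Qx = ⊥-elim (¬Qx Qx)
  ... | no _   | yes _  = s≤s (count-mono (P? ∘ suc) (Q? ∘ suc) P⊆Q)
  count-mono-< P? Q? P⊆Q (suc x) ¬Px Qx with P? zero | Q? zero
  ... | yes P0 | no ¬Q0 = ⊥-elim (¬Q0 (P⊆Q P0))
  ... | yes _  | yes _  = s≤s (count-mono-< (P? ∘ suc) (Q? ∘ suc) P⊆Q x ¬Px Qx)
  ... | no _   | yes _  = m≤n⇒m≤1+n (count-mono-< (P? ∘ suc) (Q? ∘ suc) P⊆Q x ¬Px Qx)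
  ... | no _   | no _   = count-mono-< (P? ∘ suc) (Q? ∘ suc) P⊆Q x ¬Px Qx

  count-cong : {P Q : Pred (Fin N) 0ℓ} (P? : U.Decidable P) (Q? : U.Decidable Q) →
               P ⊆ Q → Q ⊆ P → count P? ≡ count Q?
  count-cong P? Q? P⊆Q Q⊆P = ≤-antisym (count-mono P? Q? P⊆Q) (count-mono Q? P? Q⊆P)

  count-all : {P : Pred (Fin N) 0ℓ} (P? : U.Decidable P) → (∀ x → P x) → count P? ≡ N
  count-all {zero}  P? all = refl
  count-all {suc N} P? all with P? zero
  ... | yes _  = cong suc (count-all (P? ∘ suc) (all ∘ suc))
  ... | no ¬P0 = ⊥-elim (¬P0 (all zero))

  count-none : {P : Pred (Fin N) 0ℓ} (P? : U.Decidable P) → (∀ x → ¬ P x) → count P? ≡ 0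
  count-none {zero}  P? none = refl
  count-none {suc N} P? none with P? zero
  ... | yes P0 = ⊥-elim (none zero P0)
  ... | no _   = count-none (P? ∘ suc) (none ∘ suc)

  count≤ : {P : Pred (Fin N) 0ℓ} (P? : U.Decidable P) → count P? ≤ N
  count≤ {N} P? = subst (count P? ≤_) (count-all {N} (λ _ → yes tt) (λ _ → tt))
                        (count-mono P? (λ _ → yes tt) (λ _ → tt))

  count< : {P : Pred (Fin N) 0ℓ} (P? : U.Decidable P) → ∀ x → ¬ P x → count P? < N
  count< {N} P? x ¬Px = subst (count P? <_) (count-all {N} (λ _ → yes tt) (λ _ → tt))
                              (count-mono-< P? (λ _ → yes tt) (λ _ → tt) x ¬Px tt)

  count-singleton : (x : Fin N) → count (_≟F x) ≡ 1
  count-singleton {suc N} zero with zero {n = N} ≟F zero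
  ... | yes _ = cong suc (count-none {N} _ (λ _ ()))
  ... | no ¬e = ⊥-elim (¬e refl)
  count-singleton {suc N} (suc x) = trans (count-cong (λ y → suc y ≟F suc x) (λ y → y ≟F x) FP.suc-injective (cong suc))
                                   (count-singleton x)

  count-reindex : ∀ {A : Set} {B : Pred A 0ℓ} (B? : U.Decidable B) {f g : Fin N → A} →
                  (∀ i → f i ≡ g i) → count (B? ∘ f) ≡ count (B? ∘ g)
  count-reindex {B = B} B? f≗g =
    count-cong (B? ∘ _) (B? ∘ _) (λ {i} → subst B (f≗g i)) (λ {i} → subst B (sym (f≗g i)))

  count-↑ : ∀ a {b} {P : Pred (Fin (a + b)) 0ℓ} (P? : U.Decidable P) →
            count P? ≡ count (P? ∘ (_↑ˡ b)) + count (P? ∘ (a ↑ʳ_))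
  count-↑ zero    P? = refl
  count-↑ (suc a) P? with P? zero
  ... | yes _ = cong suc (count-↑ a (P? ∘ suc))
  ... | no _  = count-↑ a (P? ∘ suc)

-- Finite strict orders: heights, minimal elements, linear extensions

module Height {n : ℕ} {_≺_ : Rel (Fin n) 0ℓ}
  (spo : IsStrictPartialOrder _≡_ _≺_) (_≺?_ : Decidable _≺_) where

  open IsStrictPartialOrder spo using (irrefl) renaming (trans to ≺-trans)

  height : Fin n → ℕ
  height b = count (_≺? b)

  height-mono : ∀ {a b} → a ≺ b → height a < height b
  height-mono {a} {b} a≺b = count-mono-< (_≺? a) (_≺? b) (λ c≺a → ≺-trans c≺a a≺b) a (irrefl refl) a≺b

  height≤ : ∀ b → height b ≤ n
  height≤ b = count≤ (_≺? b)

  minimal-below : ∀ b → ∃[ m ] Star (Comparable _≺_) m b × (∀ a → ¬ a ≺ m)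
  minimal-below b = go (suc (height b)) b ≤-refl
    where
    go : ∀ fuel b → height b < fuel → ∃[ m ] Star (Comparable _≺_) m b × (∀ a → ¬ a ≺ m)
    go (suc fuel) b h with any? (_≺? b)
    ... | no nothing-below = b , ε , λ a a≺b → nothing-below (a , a≺b)
    ... | yes (a , a≺b) with go fuel a (<-≤-trans (height-mono a≺b) (s≤s⁻¹ h))
    ...   | m , m~a , minimal = m , m~a ◅◅ (inj₁ a≺b ◅ ε) , minimal

¬¬-∀-Fin : ∀ {n} {P : Pred (Fin n) 0ℓ} → (∀ i → ¬ ¬ P i) → ¬ ¬ (∀ i → P i)
¬¬-∀-Fin {zero}  ¬¬P ¬∀P = ¬∀P λ ()
¬¬-∀-Fin {suc n} ¬¬P ¬∀P =
  ¬¬P zero λ P0 → ¬¬-∀-Fin (¬¬P ∘ suc) λ P+ → ¬∀P λ { zero → P0 ; (suc i) → P+ i }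

injective⇒surjective : ∀ {N} (f : Fin N → Fin N) → Injective _≡_ _≡_ f → ∀ y → ∃[ x ] f x ≡ y
injective⇒surjective {suc N} f f-inj y with any? (λ x → f x ≟F y)
... | yes hit = hit
... | no miss = ⊥-elim (1+n≰n (FP.injective⇒≤ g-inj))
  where
  y≢f : ∀ x → y ≢ f x
  y≢f x y≡fx = miss (x , sym y≡fx)
  g : Fin (suc N) → Fin N
  g x = F.punchOut (y≢f x)
  g-inj : Injective _≡_ _≡_ g
  g-inj = f-inj ∘ FP.punchOut-injective (y≢f _) (y≢f _)

lexicographic-< : ∀ B {X Y x y} → X < Y → x < B → X * B + x < Y * B + y
lexicographic-< B {X} {Y} {x} {y} X<Y x<B = <-≤-trans (+-monoʳ-< (X * B) x<B)
  (≤-trans (≤-reflexive (+-comm (X * B) B)) (≤-trans (*-monoˡ-≤ B X<Y) (m≤m+n (Y * B) y)))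

lexicographic-≤-< : ∀ B {X Y x y} → X ≤ Y → x < y → X * B + x < Y * B + y
lexicographic-≤-< B {X} {Y} {x} {y} X≤Y x<y = <-≤-trans (+-monoʳ-< (X * B) x<y) (+-monoˡ-≤ y (*-monoˡ-≤ B X≤Y))

module LinearExtensionByKey {N : ℕ} (_≺_ : Rel (Fin N) 0ℓ) (key : Fin N → ℕ)
  (key-injective : Injective _≡_ _≡_ key) (key-mono : ∀ {a b} → a ≺ b → key a < key b) where

  open ≡-Reasoning

  rank : Fin N → ℕ
  rank z = count (λ y → key y <? key z)

  rank-mono : ∀ {a b} → key a < key b → rank a < rank b
  rank-mono {a} {b} ka<kb = count-mono-< (λ y → key y <? key a) (λ y → key y <? key b)
    (λ ky<ka → <-trans ky<ka ka<kb) a (<-irrefl refl) ka<kb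

  rank<N : ∀ z → rank z < N
  rank<N z = count< (λ y → key y <? key z) z (<-irrefl refl)

  rank-injective : Injective _≡_ _≡_ rank
  rank-injective {a} {b} ra≡rb with <-cmp (key a) (key b)
  ... | tri< ka<kb _ _ = ⊥-elim (<-irrefl ra≡rb (rank-mono ka<kb))
  ... | tri≈ _ ka≡kb _ = key-injective ka≡kb
  ... | tri> _ _ kb<ka = ⊥-elim (<-irrefl (sym ra≡rb) (rank-mono kb<ka))

  position : Fin N → Fin N
  position z = fromℕ< (rank<N z)

  toℕ-position : ∀ z → toℕ (position z) ≡ rank z
  toℕ-position z = toℕ-fromℕ< (rank<N z)

  position-injective : Injective _≡_ _≡_ position
  position-injective {a} {b} e =
    rank-injective (trans (sym (toℕ-position a)) (trans (cong toℕ e) (toℕ-position b)))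

  word : Fin N → Fin N
  word i = proj₁ (injective⇒surjective position position-injective i)

  position-word : ∀ i → position (word i) ≡ i
  position-word i = proj₂ (injective⇒surjective position position-injective i)

  word-position : ∀ z → word (position z) ≡ z
  word-position z = position-injective (position-word (position z))

  rank-word : ∀ i → rank (word i) ≡ toℕ i
  rank-word i = trans (sym (toℕ-position (word i))) (cong toℕ (position-word i))

  word-at-rank : ∀ {z y} (y<N : y < N) → rank z ≡ y → word (fromℕ< y<N) ≡ z
  word-at-rank {z} {y} y<N rz≡y = trans (cong word (toℕ-injective (begin
      toℕ (fromℕ< y<N)  ≡⟨ toℕ-fromℕ< y<N ⟩
      y                 ≡⟨ sym rz≡y ⟩
      rank z            ≡⟨ sym (toℕ-position z) ⟩
      toℕ (position z)  ∎))) (word-position z)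

  word-bijective : Bijective _≡_ _≡_ word
  word-bijective = (λ {i} {j} e → trans (sym (position-word i)) (trans (cong position e) (position-word j)))
                 , λ i → position i , λ {z} z≡pos → trans (cong word z≡pos) (word-position i)

  word-monotone : ∀ i j → word i ≺ word j → i F.< j
  word-monotone i j wi≺wj = subst₂ _<_ (rank-word i) (rank-word j) (rank-mono (key-mono wi≺wj))

  module Levels (level : Fin N → ℕ) (level-key : ∀ {a b} → level a < level b → key a < key b) where

    levelBelow? : ∀ k → U.Decidable (λ y → level y < k)
    levelBelow? k y = level y <? k

    key-level : ∀ {a b} → key a < key b → level a ≤ level b
    key-level {a} {b} ka<kb = ≮⇒≥ (λ lb<la → <-asym ka<kb (level-key lb<la))

    count-levelBelow≤rank : ∀ {k} z → k ≤ level z → count (levelBelow? k) ≤ rank z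
    count-levelBelow≤rank z k≤lz = count-mono (levelBelow? _) (λ y → key y <? key z)
      (λ ly<k → level-key (<-≤-trans ly<k k≤lz))

    rank<count-levelBelow : ∀ {k} z → level z < k → rank z < count (levelBelow? k)
    rank<count-levelBelow z lz<k = count-mono-< (λ y → key y <? key z) (levelBelow? _)
      (λ ky<kz → ≤-<-trans (key-level ky<kz) lz<k) z (<-irrefl refl) lz<k

    rank-of-unique-level : ∀ z → (∀ y → level y ≡ level z → y ≡ z) →
                           rank z ≡ count (levelBelow? (level z))
    rank-of-unique-level z unique = count-cong (λ y → key y <? key z) (levelBelow? _) below level-key
      where
      below : ∀ {y} → key y < key z → level y < level z
      below {y} ky<kz with m≤n⇒m<n∨m≡n (key-level ky<kz)
      ... | inj₁ ly<lz = ly<lz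
      ... | inj₂ ly≡lz = ⊥-elim (<-irrefl (cong key (unique y ly≡lz)) ky<kz)

-- Arithmetic of positions

swapℕ : ℕ → ℕ → ℕ → ℕ
swapℕ a b y with y ≟ a | y ≟ b
... | yes _ | _     = b
... | no _  | yes _ = a
... | no _  | no _  = y

swapℕ-cases : ∀ a b y → (y ≡ a × swapℕ a b y ≡ b) ⊎ (y ≡ b × swapℕ a b y ≡ a)
                        ⊎ (y ≢ a × y ≢ b × swapℕ a b y ≡ y)
swapℕ-cases a b y with y ≟ a | y ≟ b
... | yes y≡a | _       = inj₁ (y≡a , refl)
... | no _    | yes y≡b = inj₂ (inj₁ (y≡b , refl))
... | no y≢a  | no y≢b  = inj₂ (inj₂ (y≢a , y≢b , refl))

swapℕ-left : ∀ a b → swapℕ a b a ≡ b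
swapℕ-left a b with a ≟ a
... | yes _   = refl
... | no a≢a  = ⊥-elim (a≢a refl)

swapℕ-right : ∀ a b → swapℕ a b b ≡ a
swapℕ-right a b with b ≟ a | b ≟ b
... | yes refl | _      = refl
... | no _     | yes _  = refl
... | no _     | no b≢b = ⊥-elim (b≢b refl)

swapℕ-other : ∀ {a b y} → y ≢ a → y ≢ b → swapℕ a b y ≡ y
swapℕ-other {a} {b} {y} y≢a y≢b with y ≟ a | y ≟ b
... | yes y≡a | _       = ⊥-elim (y≢a y≡a)
... | no _    | yes y≡b = ⊥-elim (y≢b y≡b)
... | no _    | no _    = refl

toℕ-transpose : ∀ {N} (a b x : Fin N) → toℕ (transpose a b x) ≡ swapℕ (toℕ a) (toℕ b) (toℕ x)
toℕ-transpose a b x with x ≟F a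
... | yes refl = sym (swapℕ-left (toℕ x) (toℕ b))
... | no x≢a with x ≟F b
...   | yes refl = sym (swapℕ-right (toℕ a) (toℕ x))
...   | no x≢b   = sym (swapℕ-other (x≢a ∘ toℕ-injective) (x≢b ∘ toℕ-injective))

swapℕ-+ : ∀ p {a b} z → swapℕ (p + a) (p + b) (p + z) ≡ p + swapℕ a b z
swapℕ-+ p {a} {b} z with swapℕ-cases a b z
... | inj₁ (refl , e)            = trans (swapℕ-left (p + z) (p + b)) (cong (p +_) (sym e))
... | inj₂ (inj₁ (refl , e))     = trans (swapℕ-right (p + a) (p + z)) (cong (p +_) (sym e))
... | inj₂ (inj₂ (z≢a , z≢b , e)) =
  trans (swapℕ-other (z≢a ∘ +-cancelˡ-≡ p z a) (z≢b ∘ +-cancelˡ-≡ p z b)) (cong (p +_) (sym e))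

swapℕ-suc-< : ∀ {s z n} → suc s < n → z < n → swapℕ s (suc s) z < n
swapℕ-suc-< {s} {z} 1+s<n z<n with swapℕ-cases s (suc s) z
... | inj₁ (_ , e)            = subst (_< _) (sym e) 1+s<n
... | inj₂ (inj₁ (_ , e))     = subst (_< _) (sym e) (<-trans (n<1+n s) 1+s<n)
... | inj₂ (inj₂ (_ , _ , e)) = subst (_< _) (sym e) z<n

rotateSegment : ℕ → ℕ → ℕ
rotateSegment s z with <-cmp z s
... | tri< _ _ _ = suc z
... | tri≈ _ _ _ = 0
... | tri> _ _ _ = z

rotateSegment-< : ∀ {s z} → z < s → rotateSegment s z ≡ suc z
rotateSegment-< {s} {z} z<s′ with <-cmp z s
... | tri< _ _ _   = refl
... | tri≈ z≮s _ _ = ⊥-elim (z≮s z<s′)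
... | tri> z≮s _ _ = ⊥-elim (z≮s z<s′)

rotateSegment-≡ : ∀ s → rotateSegment s s ≡ 0
rotateSegment-≡ s with <-cmp s s
... | tri< _ s≢s _ = ⊥-elim (s≢s refl)
... | tri≈ _ _ _   = refl
... | tri> _ s≢s _ = ⊥-elim (s≢s refl)

rotateSegment-> : ∀ {s z} → s < z → rotateSegment s z ≡ z
rotateSegment-> {s} {z} s<z with <-cmp z s
... | tri< _ _ z≯s = ⊥-elim (z≯s s<z)
... | tri≈ _ _ z≯s = ⊥-elim (z≯s s<z)
... | tri> _ _ _   = refl

rotateSegment-zero : ∀ z → rotateSegment 0 z ≡ z
rotateSegment-zero zero    = rotateSegment-≡ 0
rotateSegment-zero (suc z) = rotateSegment-> z<s

rotateSegment-suc : ∀ {s z} → z ≢ s → z ≢ suc s → rotateSegment s z ≡ rotateSegment (suc s) z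
rotateSegment-suc {s} {z} z≢s z≢1+s with <-cmp z s
... | tri< z<s′ _ _ = sym (rotateSegment-< (m<n⇒m<1+n z<s′))
... | tri≈ _ z≡s _ = ⊥-elim (z≢s z≡s)
... | tri> _ _ s<z = sym (rotateSegment-> (≤∧≢⇒< s<z (z≢1+s ∘ sym)))

rotateSegment-swapℕ : ∀ s z → rotateSegment s (swapℕ s (suc s) z) ≡ rotateSegment (suc s) z
rotateSegment-swapℕ s z with swapℕ-cases s (suc s) z
... | inj₁ (refl , e) = begin
  rotateSegment s (swapℕ s (suc s) s) ≡⟨ cong (rotateSegment s) e ⟩
  rotateSegment s (suc s)             ≡⟨ rotateSegment-> (n<1+n s) ⟩
  suc s                               ≡⟨ sym (rotateSegment-< (n<1+n s)) ⟩
  rotateSegment (suc s) s             ∎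
  where open ≡-Reasoning
... | inj₂ (inj₁ (refl , e)) = begin
  rotateSegment s (swapℕ s (suc s) (suc s)) ≡⟨ cong (rotateSegment s) e ⟩
  rotateSegment s s                         ≡⟨ rotateSegment-≡ s ⟩
  0                                         ≡⟨ sym (rotateSegment-≡ (suc s)) ⟩
  rotateSegment (suc s) (suc s)             ∎
  where open ≡-Reasoning
... | inj₂ (inj₂ (z≢s , z≢1+s , e)) = trans (cong (rotateSegment s) e) (rotateSegment-suc z≢s z≢1+s)

reverseSegment : ℕ → ℕ → ℕ
reverseSegment s z with z ≤? s
... | yes _ = s ∸ z
... | no _  = z

reverseSegment-≤ : ∀ {s z} → z ≤ s → reverseSegment s z ≡ s ∸ z
reverseSegment-≤ {s} {z} z≤s with z ≤? s
... | yes _   = refl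
... | no z≰s  = ⊥-elim (z≰s z≤s)

reverseSegment-> : ∀ {s z} → s < z → reverseSegment s z ≡ z
reverseSegment-> {s} {z} s<z with z ≤? s
... | yes z≤s = ⊥-elim (<⇒≱ s<z z≤s)
... | no _    = refl

reverseSegment-zero : ∀ z → reverseSegment 0 z ≡ z
reverseSegment-zero zero    = reverseSegment-≤ z≤n
reverseSegment-zero (suc z) = reverseSegment-> z<s

reverseSegment-< : ∀ {s z n} → s < n → z < n → reverseSegment s z < n
reverseSegment-< {s} {z} s<n z<n with z ≤? s
... | yes _ = ≤-<-trans (m∸n≤m s z) s<n
... | no _  = z<n

rotateSegment-reverseSegment : ∀ s z → rotateSegment (suc s) (reverseSegment s z) ≡ reverseSegment (suc s) z
rotateSegment-reverseSegment s z with <-cmp z (suc s)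
... | tri< z<1+s _ _ = begin
  rotateSegment (suc s) (reverseSegment s z) ≡⟨ cong (rotateSegment (suc s)) (reverseSegment-≤ z≤s) ⟩
  rotateSegment (suc s) (s ∸ z)              ≡⟨ rotateSegment-< (s≤s (m∸n≤m s z)) ⟩
  suc (s ∸ z)                                ≡⟨ sym (+-∸-assoc 1 z≤s) ⟩
  suc s ∸ z                                  ≡⟨ sym (reverseSegment-≤ (m≤n⇒m≤1+n z≤s)) ⟩
  reverseSegment (suc s) z                   ∎
  where
  open ≡-Reasoning
  z≤s : z ≤ s
  z≤s = s≤s⁻¹ z<1+s
... | tri≈ _ refl _ = begin
  rotateSegment (suc s) (reverseSegment s (suc s)) ≡⟨ cong (rotateSegment (suc s)) (reverseSegment-> ≤-refl) ⟩
  rotateSegment (suc s) (suc s)                    ≡⟨ rotateSegment-≡ (suc s) ⟩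
  0                                                ≡⟨ sym (n∸n≡0 s) ⟩
  suc s ∸ suc s                                    ≡⟨ sym (reverseSegment-≤ (≤-refl {suc s})) ⟩
  reverseSegment (suc s) (suc s)                   ∎
  where open ≡-Reasoning
... | tri> _ _ 1+s<z = begin
  rotateSegment (suc s) (reverseSegment s z) ≡⟨ cong (rotateSegment (suc s)) (reverseSegment-> (<-trans (n<1+n s) 1+s<z)) ⟩
  rotateSegment (suc s) z                    ≡⟨ rotateSegment-> 1+s<z ⟩
  z                                          ≡⟨ sym (reverseSegment-> 1+s<z) ⟩
  reverseSegment (suc s) z                   ∎
  where open ≡-Reasoning

rotateSegment-residue : ∀ {n' r} → r < suc n' → rotateSegment n' r ≡ suc r % suc n'
rotateSegment-residue {n'} r<n with m≤n⇒m<n∨m≡n (s≤s⁻¹ r<n)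
... | inj₁ r<n' = trans (rotateSegment-< r<n') (sym (m<n⇒m%n≡m (s≤s r<n')))
... | inj₂ refl = trans (rotateSegment-≡ n') (sym (n%n≡0 (suc n')))

rotateSegment-mod : ∀ n' X → rotateSegment n' (X % suc n') ≡ suc X % suc n'
rotateSegment-mod n' X = begin
  rotateSegment n' (X % n)      ≡⟨ rotateSegment-residue (m%n<n X n) ⟩
  suc (X % n) % n               ≡⟨ sym ([m+kn]%n≡m%n (suc (X % n)) (X / n) n) ⟩
  (suc (X % n) + X / n * n) % n ≡⟨ cong (λ x → suc x % n) (sym (m≡m%n+[m/n]*n X n)) ⟩
  suc X % n                     ∎
  where
  open ≡-Reasoning
  n : ℕ
  n = suc n'

-- Colour words and the Bender–Knuth involutions

module ColourWords {N : ℕ} (_≺_ : Rel (Fin N) 0ℓ) (_≺?_ : Decidable _≺_)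
  (colour : Fin N → ℕ) (p n' : ℕ) (window≤N : p + suc n' ≤ N)
  (incomparable-to-uncoloured : ∀ {a b} → colour a ≡ 0 → ¬ a ≺ b → ¬ b ≺ a → colour b ≡ 0)
  (comparable-same-colour : ∀ {a b} → a ≺ b → colour a ≢ 0 → colour b ≢ 0 → colour a ≡ colour b)
  where

  open ≡-Reasoning

  open BK _≺_ _≺?_

  n : ℕ
  n = suc n'

  Word : Set
  Word = Fin N → Fin N

  InWindow : ℕ → Set
  InWindow y = p ≤ y × y < p + n

  PairInWindow : ℕ → Set
  PairInWindow i = p ≤ i × suc i < p + n

  pairInWindow? : ∀ i → Dec (PairInWindow i)
  pairInWindow? i = (p ≤? i) ×-dec (suc i <? p + n)

  pair⇒left : ∀ {i} → PairInWindow i → InWindow i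
  pair⇒left (p≤i , 1+i<) = p≤i , <-trans (n<1+n _) 1+i<

  pair⇒right : ∀ {i} → PairInWindow i → InWindow (suc i)
  pair⇒right (p≤i , 1+i<) = m≤n⇒m≤1+n p≤i , 1+i<

  colourAt : Word → ℕ → ℕ
  colourAt w y with y <? N
  ... | yes y<N = colour (w (fromℕ< y<N))
  ... | no _    = 0

  colourAt-< : ∀ w {y} (y<N : y < N) → colourAt w y ≡ colour (w (fromℕ< y<N))
  colourAt-< w {y} y<N with y <? N
  ... | yes _   = refl
  ... | no y≮N  = ⊥-elim (y≮N y<N)

  colourAt-≥ : ∀ w {y} → ¬ y < N → colourAt w y ≡ 0
  colourAt-≥ w {y} y≮N with y <? N
  ... | yes y<N = ⊥-elim (y≮N y<N)
  ... | no _    = refl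

  colourAt-cong : ∀ {w w′} → (∀ x → w x ≡ w′ x) → ∀ y → colourAt w y ≡ colourAt w′ y
  colourAt-cong {w} {w′} w≗w′ y with y <? N
  ... | yes _ = cong colour (w≗w′ _)
  ... | no _  = refl

  WindowColoured : Word → Set
  WindowColoured w = ∀ y → (InWindow y → colourAt w y ≢ 0) × (¬ InWindow y → colourAt w y ≡ 0)

  windowSwap : ℕ → ℕ → ℕ
  windowSwap zero    y = y
  windowSwap (suc i) y with pairInWindow? i
  ... | yes _ = swapℕ i (suc i) y
  ... | no _  = y

  windowSwap-in : ∀ {i} → PairInWindow i → ∀ y → windowSwap (suc i) y ≡ swapℕ i (suc i) y
  windowSwap-in {i} inside y with pairInWindow? i
  ... | yes _      = refl
  ... | no outside = ⊥-elim (outside inside)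

  windowSwap-out : ∀ {i} → ¬ PairInWindow i → ∀ y → windowSwap (suc i) y ≡ y
  windowSwap-out {i} outside y with pairInWindow? i
  ... | yes inside = ⊥-elim (outside inside)
  ... | no _       = refl

  PreservesWindow : (ℕ → ℕ) → Set
  PreservesWindow ρ = ∀ y → (InWindow y → InWindow (ρ y)) × (¬ InWindow y → ¬ InWindow (ρ y))

  swapℕ-preservesWindow : ∀ {i} → PairInWindow i → PreservesWindow (swapℕ i (suc i))
  swapℕ-preservesWindow {i} inside y with swapℕ-cases i (suc i) y
  ... | inj₁ (refl , e)               = (λ _ → subst InWindow (sym e) (pair⇒right inside))
                                      , (λ ¬in _ → ¬in (pair⇒left inside))
  ... | inj₂ (inj₁ (refl , e))        = (λ _ → subst InWindow (sym e) (pair⇒left inside))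
                                      , (λ ¬in _ → ¬in (pair⇒right inside))
  ... | inj₂ (inj₂ (_ , _ , e))       = (λ in-y → subst InWindow (sym e) in-y)
                                      , (λ ¬in in-ρy → ¬in (subst InWindow e in-ρy))

  windowSwap-preservesWindow : ∀ m → PreservesWindow (windowSwap m)
  windowSwap-preservesWindow zero    y = id , id
  windowSwap-preservesWindow (suc i) y with pairInWindow? i
  ... | yes inside = swapℕ-preservesWindow inside y
  ... | no _       = id , id

  Tracks : (Word → Word) → (ℕ → ℕ) → Set
  Tracks O ρ = PreservesWindow ρ
             × (∀ w → WindowColoured w → ∀ y → colourAt (O w) y ≡ colourAt w (ρ y))

  tracks-windowColoured : ∀ {O ρ} → Tracks O ρ → ∀ w → WindowColoured w → WindowColoured (O w)
  tracks-windowColoured (preserves , tracks) w coloured y =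
      (λ in-y → subst (_≢ 0) (sym (tracks w coloured y)) (proj₁ (coloured _) (proj₁ (preserves y) in-y)))
    , (λ ¬in-y → trans (tracks w coloured y) (proj₂ (coloured _) (proj₂ (preserves y) ¬in-y)))

  tracks-id : Tracks id id
  tracks-id = (λ y → id , id) , (λ w _ y → refl)

  tracks-∘ : ∀ {O₁ O₂ ρ₁ ρ₂} → Tracks O₁ ρ₁ → Tracks O₂ ρ₂ → Tracks (O₂ ∘ O₁) (ρ₁ ∘ ρ₂)
  tracks-∘ {O₁} {ρ₂ = ρ₂} t₁@(pres₁ , tr₁) (pres₂ , tr₂) =
      (λ y → proj₁ (pres₁ (ρ₂ y)) ∘ proj₁ (pres₂ y) , proj₂ (pres₁ (ρ₂ y)) ∘ proj₂ (pres₂ y))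
    , (λ w coloured y → trans (tr₂ (O₁ w) (tracks-windowColoured t₁ w coloured) y) (tr₁ w coloured (ρ₂ y)))

  module AdjacentStep {i : ℕ} (1+i<N : suc i < N) (w : Word) (coloured : WindowColoured w) where

    i<N : i < N
    i<N = <-trans (n<1+n i) 1+i<N

    a b : Fin N
    a = fromℕ< i<N
    b = fromℕ< 1+i<N

    swap-< : ∀ {y} → y < N → swapℕ i (suc i) y < N
    swap-< {y} y<N with swapℕ-cases i (suc i) y
    ... | inj₁ (_ , e)            = subst (_< N) (sym e) 1+i<N
    ... | inj₂ (inj₁ (_ , e))     = subst (_< N) (sym e) i<N
    ... | inj₂ (inj₂ (_ , _ , e)) = subst (_< N) (sym e) y<N

    swap-≥ : ∀ {y} → ¬ y < N → swapℕ i (suc i) y ≡ y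
    swap-≥ {y} y≮N with swapℕ-cases i (suc i) y
    ... | inj₁ (refl , _)         = ⊥-elim (y≮N i<N)
    ... | inj₂ (inj₁ (refl , _))  = ⊥-elim (y≮N 1+i<N)
    ... | inj₂ (inj₂ (_ , _ , e)) = e

    colourAt-transpose : ∀ y → colourAt (w ∘ transpose a b) y ≡ colourAt w (swapℕ i (suc i) y)
    colourAt-transpose y with y <? N
    ... | no y≮N = sym (trans (cong (colourAt w) (swap-≥ y≮N)) (colourAt-≥ w y≮N))
    ... | yes y<N = trans (cong (colour ∘ w) transpose≡) (sym (colourAt-< w (swap-< y<N)))
      where
      transpose≡ : transpose a b (fromℕ< y<N) ≡ fromℕ< (swap-< y<N)
      transpose≡ = toℕ-injective (begin
        toℕ (transpose a b (fromℕ< y<N))                    ≡⟨ toℕ-transpose a b (fromℕ< y<N) ⟩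
        swapℕ (toℕ a) (toℕ b) (toℕ (fromℕ< y<N))           ≡⟨ cong₂ (λ u v → swapℕ u v (toℕ (fromℕ< y<N))) (toℕ-fromℕ< i<N) (toℕ-fromℕ< 1+i<N) ⟩
        swapℕ i (suc i) (toℕ (fromℕ< y<N))                 ≡⟨ cong (swapℕ i (suc i)) (toℕ-fromℕ< y<N) ⟩
        swapℕ i (suc i) y                                   ≡⟨ sym (toℕ-fromℕ< (swap-< y<N)) ⟩
        toℕ (fromℕ< (swap-< y<N))                           ∎)

    swap-invisible : colourAt w i ≡ colourAt w (suc i) → ∀ y → colourAt w (swapℕ i (suc i) y) ≡ colourAt w y
    swap-invisible same y with swapℕ-cases i (suc i) y
    ... | inj₁ (refl , e)         = trans (cong (colourAt w) e) (sym same)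
    ... | inj₂ (inj₁ (refl , e))  = trans (cong (colourAt w) e) same
    ... | inj₂ (inj₂ (_ , _ , e)) = cong (colourAt w) e

    colour-a : colourAt w i ≡ colour (w a)
    colour-a = colourAt-< w i<N

    colour-b : colourAt w (suc i) ≡ colour (w b)
    colour-b = colourAt-< w 1+i<N

    sameColour-in : PairInWindow i → Comparable _≺_ (w a) (w b) → colourAt w i ≡ colourAt w (suc i)
    sameColour-in inside wa~wb = trans colour-a (trans (same wa~wb) (sym colour-b))
      where
      a≢0 : colour (w a) ≢ 0
      a≢0 = subst (_≢ 0) colour-a (proj₁ (coloured i) (pair⇒left inside))
      b≢0 : colour (w b) ≢ 0
      b≢0 = subst (_≢ 0) colour-b (proj₁ (coloured (suc i)) (pair⇒right inside))
      same : Comparable _≺_ (w a) (w b) → colour (w a) ≡ colour (w b)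
      same (inj₁ wa≺wb) = comparable-same-colour wa≺wb a≢0 b≢0
      same (inj₂ wb≺wa) = sym (comparable-same-colour wb≺wa b≢0 a≢0)

    sameColour-out : ¬ PairInWindow i → ¬ w a ≺ w b → ¬ w b ≺ w a → colourAt w i ≡ colourAt w (suc i)
    sameColour-out outside ¬ab ¬ba with p ≤? i
    ... | yes p≤i = trans colour-a (trans (incomparable-to-uncoloured b≡0 ¬ba ¬ab) (sym (trans colour-b b≡0)))
      where
      b≡0 : colour (w b) ≡ 0
      b≡0 = trans (sym colour-b) (proj₂ (coloured (suc i)) λ in-1+i → outside (p≤i , proj₂ in-1+i))
    ... | no p≰i = trans (trans colour-a a≡0) (sym (trans colour-b (incomparable-to-uncoloured a≡0 ¬ab ¬ba)))
      where
      a≡0 : colour (w a) ≡ 0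
      a≡0 = trans (sym colour-a) (proj₂ (coloured i) (p≰i ∘ proj₁))

    colourAt-step : ∀ y → colourAt (step a b w) y ≡ colourAt w (windowSwap (suc i) y)
    colourAt-step y with w a ≺? w b | w b ≺? w a | pairInWindow? i
    ... | yes ab | _     | yes inside  = sym (swap-invisible (sameColour-in inside (inj₁ ab)) y)
    ... | no _   | yes ba | yes inside = sym (swap-invisible (sameColour-in inside (inj₂ ba)) y)
    ... | yes _  | _     | no _        = refl
    ... | no _   | yes _ | no _        = refl
    ... | no _   | no _  | yes _       = colourAt-transpose y
    ... | no ¬ab | no ¬ba | no outside =
      trans (colourAt-transpose y) (swap-invisible (sameColour-out outside ¬ab ¬ba) y)

  tracks-t : ∀ m → Tracks (t m) (windowSwap m)
  tracks-t zero    = windowSwap-preservesWindow zero , λ w _ y → refl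
  tracks-t (suc i) = windowSwap-preservesWindow (suc i) , colourAt-t
    where
    colourAt-t : ∀ w → WindowColoured w → ∀ y → colourAt (t (suc i) w) y ≡ colourAt w (windowSwap (suc i) y)
    colourAt-t w coloured y with suc i <? N
    ... | yes 1+i<N = AdjacentStep.colourAt-step 1+i<N w coloured y
    ... | no 1+i≮N  = cong (colourAt w) (sym (windowSwap-out outside y))
      where
      outside : ¬ PairInWindow i
      outside inside = 1+i≮N (<-≤-trans (proj₂ inside) window≤N)

  -- Colour words transform contravariantly, so these compose in the reverse
  -- order of chain m = t_m ⋯ t_1 and q m.
  chainMap : ℕ → ℕ → ℕ
  chainMap zero    = id
  chainMap (suc m) = chainMap m ∘ windowSwap (suc m)

  qMap : ℕ → ℕ → ℕ
  qMap zero    = id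
  qMap (suc m) = chainMap (suc m) ∘ qMap m

  tracks-chain : ∀ m → Tracks (chain m) (chainMap m)
  tracks-chain zero    = tracks-id
  tracks-chain (suc m) = tracks-∘ (tracks-chain m) (tracks-t (suc m))

  tracks-q : ∀ m → Tracks (q m) (qMap m)
  tracks-q zero    = tracks-id
  tracks-q (suc m) = tracks-∘ (tracks-chain (suc m)) (tracks-q m)

  windowSwap-below : ∀ {i} → i < p → ∀ y → windowSwap (suc i) y ≡ y
  windowSwap-below i<p = windowSwap-out (λ inside → <⇒≱ i<p (proj₁ inside))

  chainMap-below : ∀ {m} → m ≤ p → ∀ y → chainMap m y ≡ y
  chainMap-below {zero}  _   y = refl
  chainMap-below {suc m} m<p y = trans (cong (chainMap m) (windowSwap-below m<p y)) (chainMap-below (<⇒≤ m<p) y)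

  qMap-below : ∀ {m} → m ≤ p → ∀ y → qMap m y ≡ y
  qMap-below {zero}  _   y = refl
  qMap-below {suc m} m<p y = trans (cong (chainMap (suc m)) (qMap-below (<⇒≤ m<p) y)) (chainMap-below m<p y)

  qMap-pair : ∀ y → qMap (suc p) y ≡ windowSwap (suc p) y
  qMap-pair y = trans (cong (chainMap (suc p)) (qMap-below ≤-refl y)) (chainMap-below ≤-refl _)

  p+0≤p : p + 0 ≤ p
  p+0≤p = ≤-reflexive (+-identityʳ p)

  chainMap-window : ∀ {s z} → s < n → z < n → chainMap (p + s) (p + z) ≡ p + rotateSegment s z
  chainMap-window {zero} {z} _ _ = begin
    chainMap (p + 0) (p + z) ≡⟨ chainMap-below p+0≤p (p + z) ⟩
    p + z                    ≡⟨ cong (p +_) (sym (rotateSegment-zero z)) ⟩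
    p + rotateSegment 0 z    ∎
  chainMap-window {suc s} {z} 1+s<n z<n = begin
    chainMap (p + suc s) (p + z)                           ≡⟨ cong (λ m → chainMap m (p + z)) (+-suc p s) ⟩
    chainMap (p + s) (windowSwap (suc (p + s)) (p + z))    ≡⟨ cong (chainMap (p + s)) (windowSwap-in inside (p + z)) ⟩
    chainMap (p + s) (swapℕ (p + s) (suc (p + s)) (p + z)) ≡⟨ cong (λ b → chainMap (p + s) (swapℕ (p + s) b (p + z))) (sym (+-suc p s)) ⟩
    chainMap (p + s) (swapℕ (p + s) (p + suc s) (p + z))  ≡⟨ cong (chainMap (p + s)) (swapℕ-+ p z) ⟩
    chainMap (p + s) (p + swapℕ s (suc s) z)               ≡⟨ chainMap-window (<-trans (n<1+n s) 1+s<n) (swapℕ-suc-< 1+s<n z<n) ⟩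
    p + rotateSegment s (swapℕ s (suc s) z)                ≡⟨ cong (p +_) (rotateSegment-swapℕ s z) ⟩
    p + rotateSegment (suc s) z                            ∎
    where
    inside : PairInWindow (p + s)
    inside = m≤m+n p s , subst (_< p + n) (+-suc p s) (+-monoʳ-< p 1+s<n)

  qMap-window : ∀ {s z} → s < n → z < n → qMap (p + s) (p + z) ≡ p + reverseSegment s z
  qMap-window {zero} {z} _ _ = begin
    qMap (p + 0) (p + z)   ≡⟨ qMap-below p+0≤p (p + z) ⟩
    p + z                  ≡⟨ cong (p +_) (sym (reverseSegment-zero z)) ⟩
    p + reverseSegment 0 z ∎
  qMap-window {suc s} {z} 1+s<n z<n = begin
    qMap (p + suc s) (p + z)                        ≡⟨ cong (λ m → qMap m (p + z)) (+-suc p s) ⟩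
    chainMap (suc (p + s)) (qMap (p + s) (p + z))   ≡⟨ cong (chainMap (suc (p + s))) (qMap-window s<n z<n) ⟩
    chainMap (suc (p + s)) (p + reverseSegment s z) ≡⟨ cong (λ m → chainMap m (p + reverseSegment s z)) (sym (+-suc p s)) ⟩
    chainMap (p + suc s) (p + reverseSegment s z)   ≡⟨ chainMap-window 1+s<n (reverseSegment-< s<n z<n) ⟩
    p + rotateSegment (suc s) (reverseSegment s z)  ≡⟨ cong (p +_) (rotateSegment-reverseSegment s z) ⟩
    p + reverseSegment (suc s) z                    ∎
    where
    s<n : s < n
    s<n = <-trans (n<1+n s) 1+s<n

  chainMap-beyond : ∀ e y → chainMap (p + n' + e) y ≡ chainMap (p + n') y
  chainMap-beyond zero    y = cong (λ m → chainMap m y) (+-identityʳ (p + n'))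
  chainMap-beyond (suc e) y = begin
    chainMap (p + n' + suc e) y                             ≡⟨ cong (λ m → chainMap m y) (+-suc (p + n') e) ⟩
    chainMap (p + n' + e) (windowSwap (suc (p + n' + e)) y) ≡⟨ cong (chainMap (p + n' + e)) (windowSwap-out outside y) ⟩
    chainMap (p + n' + e) y                                 ≡⟨ chainMap-beyond e y ⟩
    chainMap (p + n') y                                     ∎
    where
    outside : ¬ PairInWindow (p + n' + e)
    outside inside = <⇒≱ (proj₂ inside) (subst (_≤ suc (p + n' + e)) (sym (+-suc p n')) (s≤s (m≤m+n (p + n') e)))

  qMap-rotation-+ : ∀ e {z} → z < n → qMap (p + n' + e) (p + z) ≡ p + (n' + e ∸ z) % n
  qMap-rotation-+ zero {z} z<n = begin
    qMap (p + n' + 0) (p + z) ≡⟨ cong (λ m → qMap m (p + z)) (+-identityʳ (p + n')) ⟩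
    qMap (p + n') (p + z)     ≡⟨ qMap-window ≤-refl z<n ⟩
    p + reverseSegment n' z   ≡⟨ cong (p +_) (reverseSegment-≤ (s≤s⁻¹ z<n)) ⟩
    p + (n' ∸ z)              ≡⟨ cong (p +_) (sym (m<n⇒m%n≡m (s≤s (m∸n≤m n' z)))) ⟩
    p + (n' ∸ z) % n          ≡⟨ cong (λ x → p + (x ∸ z) % n) (sym (+-identityʳ n')) ⟩
    p + (n' + 0 ∸ z) % n      ∎
  qMap-rotation-+ (suc e) {z} z<n = begin
    qMap (p + n' + suc e) (p + z)                          ≡⟨ cong (λ m → qMap m (p + z)) (+-suc (p + n') e) ⟩
    chainMap (suc (p + n' + e)) (qMap (p + n' + e) (p + z)) ≡⟨ cong (chainMap (suc (p + n' + e))) (qMap-rotation-+ e z<n) ⟩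
    chainMap (suc (p + n' + e)) (p + X % n)                ≡⟨ cong (λ m → chainMap m (p + X % n)) (sym (+-suc (p + n') e)) ⟩
    chainMap (p + n' + suc e) (p + X % n)                  ≡⟨ chainMap-beyond (suc e) (p + X % n) ⟩
    chainMap (p + n') (p + X % n)                          ≡⟨ chainMap-window ≤-refl (m%n<n X n) ⟩
    p + rotateSegment n' (X % n)                           ≡⟨ cong (p +_) (rotateSegment-mod n' X) ⟩
    p + suc X % n                                          ≡⟨ cong (λ x → p + x % n) (sym (+-∸-assoc 1 z≤X)) ⟩
    p + (suc (n' + e) ∸ z) % n                             ≡⟨ cong (λ x → p + (x ∸ z) % n) (sym (+-suc n' e)) ⟩
    p + (n' + suc e ∸ z) % n                               ∎
    where
    X : ℕ
    X = n' + e ∸ z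
    z≤X : z ≤ n' + e
    z≤X = ≤-trans (s≤s⁻¹ z<n) (m≤m+n n' e)

  qMap-rotation : ∀ {A z} → n' ≤ A → z < n → qMap (p + A) (p + z) ≡ p + (A ∸ z) % n
  qMap-rotation {A} {z} n'≤A z<n = begin
    qMap (p + A) (p + z)             ≡⟨ cong (λ m → qMap m (p + z)) (sym (trans (+-assoc p n' (A ∸ n')) (cong (p +_) A≡))) ⟩
    qMap (p + n' + (A ∸ n')) (p + z) ≡⟨ qMap-rotation-+ (A ∸ n') z<n ⟩
    p + (n' + (A ∸ n') ∸ z) % n      ≡⟨ cong (λ x → p + (x ∸ z) % n) A≡ ⟩
    p + (A ∸ z) % n                  ∎
    where
    A≡ : n' + (A ∸ n') ≡ A
    A≡ = m+[n∸m]≡n n'≤A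

  cactusStep : ℕ → Word → Word
  cactusStep A = t (suc p) ∘ qjk A (suc (p + A))

  cactusMap : ℕ → ℕ → ℕ
  cactusMap A = qMap (p + A) ∘ qMap (suc (p + A) ∸ A) ∘ qMap (p + A) ∘ windowSwap (suc p)

  tracks-cactusStep : ∀ A → Tracks (cactusStep A) (cactusMap A)
  tracks-cactusStep A =
    tracks-∘ (tracks-∘ (tracks-∘ (tracks-q (p + A)) (tracks-q (suc (p + A) ∸ A))) (tracks-q (p + A))) (tracks-t (suc p))

  colourAt-cactus-involution : ∀ A w → WindowColoured w → (∀ x → cactusStep A (cactusStep A w) x ≡ w x) →
                               ∀ y → colourAt w y ≡ colourAt w (cactusMap A (cactusMap A y))
  colourAt-cactus-involution A w coloured involution y =
    trans (colourAt-cong (sym ∘ involution) y)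
          (proj₂ (tracks-∘ (tracks-cactusStep A) (tracks-cactusStep A)) w coloured y)

  windowSwap-first : 1 ≤ n' → ∀ z → windowSwap (suc p) (p + z) ≡ p + swapℕ 0 1 z
  windowSwap-first 1≤n' z = begin
    windowSwap (suc p) (p + z)     ≡⟨ windowSwap-in inside (p + z) ⟩
    swapℕ p (suc p) (p + z)        ≡⟨ cong₂ (λ a b → swapℕ a b (p + z)) (sym (+-identityʳ p)) (+-comm 1 p) ⟩
    swapℕ (p + 0) (p + 1) (p + z)  ≡⟨ swapℕ-+ p z ⟩
    p + swapℕ 0 1 z                ∎
    where
    inside : PairInWindow p
    inside = ≤-refl , subst (_< p + n) (+-comm p 1) (+-monoʳ-< p (s≤s 1≤n'))

  -- A window position is traced through the four factors of cactusMap A in turn.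
  cactusMap-window : ∀ {A z z₁ z₂ z₃ z₄} → 1 ≤ n' → n' ≤ A →
    swapℕ 0 1 z ≡ z₁ → z₁ < n → (A ∸ z₁) % n ≡ z₂ →
    swapℕ 0 1 z₂ ≡ z₃ → z₃ < n → (A ∸ z₃) % n ≡ z₄ →
    cactusMap A (p + z) ≡ p + z₄
  cactusMap-window {A} {z} {z₁} {z₂} {z₃} {z₄} 1≤n' n'≤A e₁ z₁<n e₂ e₃ z₃<n e₄ = begin
    qMap (p + A) (qMap (suc (p + A) ∸ A) (qMap (p + A) (windowSwap (suc p) (p + z))))
      ≡⟨ cong (qMap (p + A) ∘ qMap (suc (p + A) ∸ A) ∘ qMap (p + A))
              (trans (windowSwap-first 1≤n' z) (cong (p +_) e₁)) ⟩
    qMap (p + A) (qMap (suc (p + A) ∸ A) (qMap (p + A) (p + z₁)))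
      ≡⟨ cong (qMap (p + A) ∘ qMap (suc (p + A) ∸ A)) (trans (qMap-rotation n'≤A z₁<n) (cong (p +_) e₂)) ⟩
    qMap (p + A) (qMap (suc (p + A) ∸ A) (p + z₂))
      ≡⟨ cong (qMap (p + A)) (trans (cong (λ m → qMap m (p + z₂)) 1+p+A∸A) (qMap-pair (p + z₂))) ⟩
    qMap (p + A) (windowSwap (suc p) (p + z₂))
      ≡⟨ cong (qMap (p + A)) (trans (windowSwap-first 1≤n' z₂) (cong (p +_) e₃)) ⟩
    qMap (p + A) (p + z₃)
      ≡⟨ trans (qMap-rotation n'≤A z₃<n) (cong (p +_) e₄) ⟩
    p + z₄ ∎
    where
    1+p+A∸A : suc (p + A) ∸ A ≡ suc p
    1+p+A∸A = trans (+-∸-assoc 1 (m≤n+m A p)) (cong suc (m+n∸n≡m p A))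

  module _ (2≤n' : 2 ≤ n') (s : ℕ) where

    private
      1≤n' : 1 ≤ n'
      1≤n' = ≤-trans (s≤s z≤n) 2≤n'

      1<n : 1 < n
      1<n = s≤s 1≤n'

      residue : ∀ δ k → k ≤ δ + n → (δ + suc s * n ∸ k) % n ≡ (δ + n ∸ k) % n
      residue δ k k≤δ+n = begin
        (δ + (n + s * n) ∸ k) % n ≡⟨ cong (λ x → (x ∸ k) % n) (sym (+-assoc δ n (s * n))) ⟩
        (δ + n + s * n ∸ k) % n   ≡⟨ cong (_% n) (+-∸-comm (s * n) k≤δ+n) ⟩
        (δ + n ∸ k + s * n) % n   ≡⟨ [m+kn]%n≡m%n (δ + n ∸ k) s n ⟩
        (δ + n ∸ k) % n           ∎

      n'≤A : ∀ δ → n' ≤ δ + suc s * n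
      n'≤A δ = ≤-trans (n≤1+n n') (≤-trans (m≤m+n n (s * n)) (m≤n+m _ δ))

    cactusMap²-multiple : cactusMap (suc s * n) (cactusMap (suc s * n) (p + 1)) ≡ p + 0
    cactusMap²-multiple = trans (cong (cactusMap A) there) back
      where
      A : ℕ
      A = 0 + suc s * n
      A%n : (A ∸ 0) % n ≡ 0
      A%n = trans (residue 0 0 z≤n) (n%n≡0 n)
      there : cactusMap A (p + 1) ≡ p + n'
      there = cactusMap-window 1≤n' (n'≤A 0) refl z<s A%n refl 1<n
                (trans (residue 0 1 (s≤s z≤n)) (m<n⇒m%n≡m ≤-refl))
      back : cactusMap A (p + n') ≡ p + 0
      back = cactusMap-window 1≤n' (n'≤A 0) (swapℕ-other (λ { refl → <⇒≱ 2≤n' z≤n }) (λ { refl → <⇒≱ 2≤n' ≤-refl }))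
                ≤-refl (trans (residue 0 n' (n≤1+n n')) (trans (cong (_% n) (m+n∸n≡m 1 n')) (m<n⇒m%n≡m 1<n)))
                refl z<s A%n

    cactusMap²-multiple+2 : cactusMap (2 + suc s * n) (cactusMap (2 + suc s * n) (p + 0)) ≡ p + 1
    cactusMap²-multiple+2 = trans (cong (cactusMap A) there) back
      where
      A : ℕ
      A = 2 + suc s * n
      A∸1%n : (A ∸ 1) % n ≡ 1
      A∸1%n = trans (residue 2 1 (s≤s z≤n)) (trans ([m+n]%n≡m%n 1 n) (m<n⇒m%n≡m 1<n))
      there : cactusMap A (p + 0) ≡ p + 2
      there = cactusMap-window 1≤n' (n'≤A 2) refl 1<n A∸1%n refl z<s
                (trans (residue 2 0 z≤n) (trans ([m+n]%n≡m%n 2 n) (m<n⇒m%n≡m (s≤s 2≤n'))))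
      back : cactusMap A (p + 2) ≡ p + 1
      back = cactusMap-window 1≤n' (n'≤A 2) refl (s≤s 2≤n') (trans (residue 2 2 (m≤m+n 2 n)) (n%n≡0 n))
                refl 1<n A∸1%n

    cactus-violated : ∀ {δ} → δ ≡ 0 ⊎ δ ≡ 2 → ∀ w → WindowColoured w →
                      colourAt w (p + 0) ≢ colourAt w (p + 1) →
                      ¬ (∀ x → cactusStep (δ + suc s * n) (cactusStep (δ + suc s * n) w) x ≡ w x)
    cactus-violated (inj₁ refl) w coloured different involution =
      different (sym (trans (colourAt-cactus-involution _ w coloured involution (p + 1))
                            (cong (colourAt w) cactusMap²-multiple)))
    cactus-violated (inj₂ refl) w coloured different involution =
      different (trans (colourAt-cactus-involution _ w coloured involution (p + 0))
                       (cong (colourAt w) cactusMap²-multiple+2))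

-- Disconnected middle summands

-- A = δ + (s+1)n is the index j of a relation (t_i q_jk)² = id, with i = p+1
-- and k = p+A+1, that fails when D is disconnected.
Obstruction : ℕ → ℕ → ℕ → Set
Obstruction p n q = ∃[ δ ] ∃[ s ] (δ ≡ 0 ⊎ δ ≡ 2) × p + 3 ≤ δ + suc s * n × p + (δ + suc s * n) < p + n + q

module OrdinalSum {p n q : ℕ} (_<P_ : Rel (Fin p) 0ℓ) (_<D_ : Rel (Fin n) 0ℓ) (_<Q_ : Rel (Fin q) 0ℓ) where

  open ≡-Reasoning

  N : ℕ
  N = p + n + q

  _<R_ : Rel (Fin N) 0ℓ
  _<R_ = ordRel (ordRel _<P_ _<D_) _<Q_

  data Block : Set where
    inP : Fin p → Block
    inD : Fin n → Block
    inQ : Fin q → Block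

  blockᴾᴰ : Fin p ⊎ Fin n → Block
  blockᴾᴰ = [ inP , inD ]

  blockOf : Fin (p + n) ⊎ Fin q → Block
  blockOf = [ blockᴾᴰ ∘ splitAt p , inQ ]

  block : Fin N → Block
  block z = blockOf (splitAt (p + n) z)

  embed : Block → Fin N
  embed (inP a) = (a ↑ˡ n) ↑ˡ q
  embed (inD d) = (p ↑ʳ d) ↑ˡ q
  embed (inQ c) = (p + n) ↑ʳ c

  embed-block : ∀ z → embed (block z) ≡ z
  embed-block z = trans (embed-blockOf (splitAt (p + n) z)) (FP.join-splitAt (p + n) q z)
    where
    embed-blockᴾᴰ : ∀ x → embed (blockᴾᴰ x) ≡ F.join p n x ↑ˡ q
    embed-blockᴾᴰ (inj₁ a) = refl
    embed-blockᴾᴰ (inj₂ d) = refl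
    embed-blockOf : ∀ s → embed (blockOf s) ≡ F.join (p + n) q s
    embed-blockOf (inj₁ u) = trans (embed-blockᴾᴰ (splitAt p u)) (cong (_↑ˡ q) (FP.join-splitAt p n u))
    embed-blockOf (inj₂ c) = refl

  block-embed : ∀ v → block (embed v) ≡ v
  block-embed (inP a) rewrite FP.splitAt-↑ˡ (p + n) (a ↑ˡ n) q | FP.splitAt-↑ˡ p a n = refl
  block-embed (inD d) rewrite FP.splitAt-↑ˡ (p + n) (p ↑ʳ d) q | FP.splitAt-↑ʳ p n d = refl
  block-embed (inQ c) rewrite FP.splitAt-↑ʳ (p + n) q c = refl

  _<B_ : Block → Block → Set
  inP a <B inP b = a <P b
  inD a <B inD b = a <D b
  inQ a <B inQ b = a <Q b
  inP _ <B _     = ⊤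
  inD _ <B inQ _ = ⊤
  _     <B _     = ⊥

  <R⇒<B : ∀ {a b} → a <R b → block a <B block b
  <R⇒<B {a} {b} = outer (splitAt (p + n) a) (splitAt (p + n) b)
    where
    inner : ∀ x y → ordRel' _<P_ _<D_ x y → blockᴾᴰ x <B blockᴾᴰ y
    inner (inj₁ a) (inj₁ b) a<b = a<b
    inner (inj₁ a) (inj₂ d) _   = tt
    inner (inj₂ d) (inj₂ e) d<e = d<e
    outer : ∀ s t → ordRel' (ordRel _<P_ _<D_) _<Q_ s t → blockOf s <B blockOf t
    outer (inj₁ u) (inj₁ v) u<v = inner (splitAt p u) (splitAt p v) u<v
    outer (inj₁ u) (inj₂ c) _ with splitAt p u
    ... | inj₁ _ = tt
    ... | inj₂ _ = tt
    outer (inj₂ c) (inj₂ d) c<d = c<d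

  <B⇒<R : ∀ {a b} → block a <B block b → a <R b
  <B⇒<R {a} {b} = outer (splitAt (p + n) a) (splitAt (p + n) b)
    where
    inner : ∀ x y → blockᴾᴰ x <B blockᴾᴰ y → ordRel' _<P_ _<D_ x y
    inner (inj₁ a) (inj₁ b) a<b = a<b
    inner (inj₁ a) (inj₂ d) _   = tt
    inner (inj₂ d) (inj₂ e) d<e = d<e
    outer : ∀ s t → blockOf s <B blockOf t → ordRel' (ordRel _<P_ _<D_) _<Q_ s t
    outer (inj₁ u) (inj₁ v) u<v = inner (splitAt p u) (splitAt p v) u<v
    outer (inj₁ u) (inj₂ c) _   = tt
    outer (inj₂ c) (inj₁ v) c<v with splitAt p v
    outer (inj₂ c) (inj₁ v) () | inj₁ _
    outer (inj₂ c) (inj₁ v) () | inj₂ _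
    outer (inj₂ c) (inj₂ d) c<d = c<d

  count-block : {B : Pred Block 0ℓ} (B? : U.Decidable B) →
                count (B? ∘ block) ≡ count (B? ∘ inP) + count (B? ∘ inD) + count (B? ∘ inQ)
  count-block B? = begin
    count (B? ∘ block)
      ≡⟨ count-↑ (p + n) (B? ∘ block) ⟩
    count (B? ∘ block ∘ (_↑ˡ q)) + count (B? ∘ block ∘ ((p + n) ↑ʳ_))
      ≡⟨ cong₂ _+_ (count-reindex B? (λ u → cong blockOf (FP.splitAt-↑ˡ (p + n) u q)))
                   (count-reindex B? (λ c → cong blockOf (FP.splitAt-↑ʳ (p + n) q c))) ⟩
    count (B? ∘ blockᴾᴰ ∘ splitAt p) + count (B? ∘ inQ)
      ≡⟨ cong (_+ count (B? ∘ inQ)) (count-↑ p (B? ∘ blockᴾᴰ ∘ splitAt p)) ⟩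
    count (B? ∘ blockᴾᴰ ∘ splitAt p ∘ (_↑ˡ n)) + count (B? ∘ blockᴾᴰ ∘ splitAt p ∘ (p ↑ʳ_)) + count (B? ∘ inQ)
      ≡⟨ cong (_+ count (B? ∘ inQ)) (cong₂ _+_ (count-reindex B? (λ a → cong blockᴾᴰ (FP.splitAt-↑ˡ p a n)))
                                               (count-reindex B? (λ d → cong blockᴾᴰ (FP.splitAt-↑ʳ p n d)))) ⟩
    count (B? ∘ inP) + count (B? ∘ inD) + count (B? ∘ inQ) ∎

module MinimaFirstExtension {p n' q : ℕ} {_<P_ : Rel (Fin p) 0ℓ} {_<D_ : Rel (Fin (suc n')) 0ℓ} {_<Q_ : Rel (Fin q) 0ℓ}
  (sP : IsStrictPartialOrder _≡_ _<P_) (sD : IsStrictPartialOrder _≡_ _<D_) (sQ : IsStrictPartialOrder _≡_ _<Q_)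
  (dP : Decidable _<P_) (dD : Decidable _<D_) (dQ : Decidable _<Q_)
  (x₀ y₀ : Fin (suc n')) (x₀-minimal : ∀ d → ¬ d <D x₀) (y₀-minimal : ∀ d → ¬ d <D y₀)
  (x₀~? : ∀ d → Dec (Star (Comparable _<D_) x₀ d)) (x₀≁y₀ : ¬ Star (Comparable _<D_) x₀ y₀)
  where

  open ≡-Reasoning

  open OrdinalSum _<P_ _<D_ _<Q_

  n : ℕ
  n = suc n'

  _<R?_ : Decidable _<R_
  _<R?_ = ordDec (ordDec dP dD) dQ

  x₀≢y₀ : x₀ ≢ y₀
  x₀≢y₀ refl = x₀≁y₀ ε

  levelD : Fin n → ℕ
  levelD d with d ≟F x₀ | d ≟F y₀
  ... | yes _ | _     = 0
  ... | no _  | yes _ = 1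
  ... | no _  | no _  = 2

  levelD-x₀ : levelD x₀ ≡ 0
  levelD-x₀ with x₀ ≟F x₀
  ... | yes _   = refl
  ... | no x≢x  = ⊥-elim (x≢x refl)

  levelD-y₀ : levelD y₀ ≡ 1
  levelD-y₀ with y₀ ≟F x₀ | y₀ ≟F y₀
  ... | yes y≡x | _      = ⊥-elim (x₀≢y₀ (sym y≡x))
  ... | no _    | yes _  = refl
  ... | no _    | no y≢y = ⊥-elim (y≢y refl)

  levelD≤2 : ∀ d → levelD d ≤ 2
  levelD≤2 d with d ≟F x₀ | d ≟F y₀
  ... | yes _ | _     = z≤n
  ... | no _  | yes _ = s≤s z≤n
  ... | no _  | no _  = ≤-refl

  levelD-above : ∀ {d e} → d <D e → levelD e ≡ 2
  levelD-above {d} {e} d<e with e ≟F x₀ | e ≟F y₀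
  ... | yes refl | _        = ⊥-elim (x₀-minimal d d<e)
  ... | no _     | yes refl = ⊥-elim (y₀-minimal d d<e)
  ... | no _     | no _     = refl

  levelD≡0 : ∀ {d} → levelD d ≡ 0 → d ≡ x₀
  levelD≡0 {d} with d ≟F x₀ | d ≟F y₀
  ... | yes d≡x₀ | _     = λ _ → d≡x₀
  ... | no _     | yes _ = λ ()
  ... | no _     | no _  = λ ()

  levelD≡1 : ∀ {d} → levelD d ≡ 1 → d ≡ y₀
  levelD≡1 {d} with d ≟F x₀ | d ≟F y₀
  ... | yes _ | _        = λ ()
  ... | no _  | yes d≡y₀ = λ _ → d≡y₀
  ... | no _  | no _     = λ ()

  -- Keys order the blocks P < x₀ < y₀ < rest of D < Q, then by height inside a block.
  level : Block → ℕ
  level (inP _) = 0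
  level (inD d) = suc (levelD d)
  level (inQ _) = 4

  module HP = Height sP dP
  module HD = Height sD dD
  module HQ = Height sQ dQ

  height : Block → ℕ
  height (inP a) = HP.height a
  height (inD d) = HD.height d
  height (inQ c) = HQ.height c

  B : ℕ
  B = suc N

  height<B : ∀ v → height v < B
  height<B (inP a) = s≤s (≤-trans (HP.height≤ a) (≤-trans (m≤m+n p n) (m≤m+n (p + n) q)))
  height<B (inD d) = s≤s (≤-trans (HD.height≤ d) (≤-trans (m≤n+m n p) (m≤m+n (p + n) q)))
  height<B (inQ c) = s≤s (≤-trans (HQ.height≤ c) (m≤n+m q (p + n)))

  blockKey : Block → ℕ
  blockKey v = level v * B + height v

  blockKey-mono : ∀ {v w} → v <B w → blockKey v < blockKey w
  blockKey-mono {inP a} {inP b} a<b = lexicographic-≤-< B {0} {0} ≤-refl (HP.height-mono a<b)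
  blockKey-mono {inP a} {inD d} _   = lexicographic-< B {0} {level (inD d)} z<s (height<B (inP a))
  blockKey-mono {inP a} {inQ c} _   = lexicographic-< B {0} {4} z<s (height<B (inP a))
  blockKey-mono {inD d} {inD e} d<e =
    lexicographic-≤-< B {level (inD d)} {level (inD e)} (s≤s (subst (levelD d ≤_) (sym (levelD-above d<e)) (levelD≤2 d))) (HD.height-mono d<e)
  blockKey-mono {inD d} {inQ c} _   = lexicographic-< B {level (inD d)} {4} (s≤s (s≤s (levelD≤2 d))) (height<B (inD d))
  blockKey-mono {inQ c} {inQ e} c<e = lexicographic-≤-< B {4} {4} ≤-refl (HQ.height-mono c<e)

  key : Fin N → ℕ
  key z = blockKey (block z) * B + toℕ z

  toℕ<B : ∀ (z : Fin N) → toℕ z < B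
  toℕ<B z = <-trans (FP.toℕ<n z) (n<1+n N)

  key-mono : ∀ {a b} → a <R b → key a < key b
  key-mono {a} {b} a<b = lexicographic-< B {blockKey (block a)} {blockKey (block b)} (blockKey-mono {block a} {block b} (<R⇒<B a<b)) (toℕ<B a)

  level-key : ∀ {a b} → level (block a) < level (block b) → key a < key b
  level-key {a} {b} la<lb = lexicographic-< B {blockKey (block a)} {blockKey (block b)} (lexicographic-< B {level (block a)} {level (block b)} la<lb (height<B (block a))) (toℕ<B a)

  key-injective : Injective _≡_ _≡_ key
  key-injective {a} {b} ka≡kb = toℕ-injective (trans (sym (key%B a)) (trans (cong (_% B) ka≡kb) (key%B b)))
    where
    key%B : ∀ z → key z % B ≡ toℕ z
    key%B z = trans (cong (_% B) (+-comm (blockKey (block z) * B) (toℕ z)))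
                    (trans ([m+kn]%n≡m%n (toℕ z) (blockKey (block z)) B) (m<n⇒m%n≡m (toℕ<B z)))

  open LinearExtensionByKey _<R_ key key-injective key-mono
  open Levels (level ∘ block) level-key

  count-levelBelow : ∀ k → count (levelBelow? k) ≡
    count {p} (λ _ → 0 <? k) + count {n} (λ d → suc (levelD d) <? k) + count {q} (λ _ → 4 <? k)
  count-levelBelow k = count-block (λ v → level v <? k)

  count-levelBelow-1 : count (levelBelow? 1) ≡ p
  count-levelBelow-1 = begin
    count (levelBelow? 1)
      ≡⟨ count-levelBelow 1 ⟩
    count {p} (λ _ → 0 <? 1) + count {n} (λ d → suc (levelD d) <? 1) + count {q} (λ _ → 4 <? 1)
      ≡⟨ cong₂ _+_ (cong₂ _+_ (count-all {p} (λ _ → 0 <? 1) (λ _ → z<s)) (count-none (λ d → suc (levelD d) <? 1) (λ _ → λ { (s≤s ()) })))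
                   (count-none {q} (λ _ → 4 <? 1) (λ _ → λ { (s≤s ()) })) ⟩
    p + 0 + 0
      ≡⟨ trans (+-identityʳ (p + 0)) (+-identityʳ p) ⟩
    p ∎

  count-levelBelow-2 : count (levelBelow? 2) ≡ p + 1
  count-levelBelow-2 = begin
    count (levelBelow? 2)
      ≡⟨ count-levelBelow 2 ⟩
    count {p} (λ _ → 0 <? 2) + count {n} (λ d → suc (levelD d) <? 2) + count {q} (λ _ → 4 <? 2)
      ≡⟨ cong₂ _+_ (cong₂ _+_ (count-all {p} (λ _ → 0 <? 2) (λ _ → z<s)) only-x₀)
                   (count-none {q} (λ _ → 4 <? 2) (λ _ → λ { (s≤s (s≤s ())) })) ⟩
    p + 1 + 0
      ≡⟨ +-identityʳ (p + 1) ⟩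
    p + 1 ∎
    where
    only-x₀ : count {n} (λ d → suc (levelD d) <? 2) ≡ 1
    only-x₀ = trans (count-cong (λ d → suc (levelD d) <? 2) (_≟F x₀)
                                (λ lvl<2 → levelD≡0 (n<1⇒n≡0 (s≤s⁻¹ lvl<2)))
                                (λ { refl → s≤s (s≤s (≤-reflexive levelD-x₀)) }))
                    (count-singleton x₀)

  count-levelBelow-4 : count (levelBelow? 4) ≡ p + n
  count-levelBelow-4 = begin
    count (levelBelow? 4)
      ≡⟨ count-levelBelow 4 ⟩
    count {p} (λ _ → 0 <? 4) + count {n} (λ d → suc (levelD d) <? 4) + count {q} (λ _ → 4 <? 4)
      ≡⟨ cong₂ _+_ (cong₂ _+_ (count-all {p} (λ _ → 0 <? 4) (λ _ → z<s))
                               (count-all (λ d → suc (levelD d) <? 4) (λ d → s≤s (s≤s (levelD≤2 d)))))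
                   (count-none {q} (λ _ → 4 <? 4) (λ _ → <-irrefl refl)) ⟩
    p + n + 0
      ≡⟨ +-identityʳ (p + n) ⟩
    p + n ∎

  rank-inD : ∀ d → (∀ e → levelD e ≡ levelD d → e ≡ d) →
             rank (embed (inD d)) ≡ count (levelBelow? (suc (levelD d)))
  rank-inD d unique = trans (rank-of-unique-level (embed (inD d)) unique-level)
                            (cong (count ∘ levelBelow?) (cong level (block-embed (inD d))))
    where
    same-block : ∀ v → level v ≡ suc (levelD d) → v ≡ inD d
    same-block (inD e) l≡ = cong inD (unique e (suc-injective l≡))
    same-block (inQ _) l≡ = ⊥-elim (<-irrefl (sym l≡) (s≤s (s≤s (levelD≤2 d))))
    unique-level : ∀ y → level (block y) ≡ level (block (embed (inD d))) → y ≡ embed (inD d)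
    unique-level y l≡ = trans (sym (embed-block y))
      (cong embed (same-block (block y) (trans l≡ (cong level (block-embed (inD d))))))

  x₀* y₀* : Fin N
  x₀* = embed (inD x₀)
  y₀* = embed (inD y₀)

  rank-x₀* : rank x₀* ≡ p
  rank-x₀* = begin
    rank x₀*                                ≡⟨ rank-inD x₀ (λ e l≡ → levelD≡0 (trans l≡ levelD-x₀)) ⟩
    count (levelBelow? (suc (levelD x₀)))   ≡⟨ cong (count ∘ levelBelow? ∘ suc) levelD-x₀ ⟩
    count (levelBelow? 1)                   ≡⟨ count-levelBelow-1 ⟩
    p                                       ∎

  rank-y₀* : rank y₀* ≡ p + 1
  rank-y₀* = begin
    rank y₀*                                ≡⟨ rank-inD y₀ (λ e l≡ → levelD≡1 (trans l≡ levelD-y₀)) ⟩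
    count (levelBelow? (suc (levelD y₀)))   ≡⟨ cong (count ∘ levelBelow? ∘ suc) levelD-y₀ ⟩
    count (levelBelow? 2)                   ≡⟨ count-levelBelow-2 ⟩
    p + 1                                   ∎

  componentColour : ∀ {A : Set} → Dec A → ℕ
  componentColour (yes _) = 1
  componentColour (no _)  = 2

  componentColour≢0 : ∀ {A : Set} (A? : Dec A) → componentColour A? ≢ 0
  componentColour≢0 (yes _) ()
  componentColour≢0 (no _)  ()

  blockColour : Block → ℕ
  blockColour (inD d) = componentColour (x₀~? d)
  blockColour _       = 0

  colour : Fin N → ℕ
  colour = blockColour ∘ block

  incomparable-to-uncoloured : ∀ {a b} → colour a ≡ 0 → ¬ a <R b → ¬ b <R a → colour b ≡ 0
  incomparable-to-uncoloured {a} {b} ca≡0 ¬a<b ¬b<a = go (block a) (block b) ca≡0 (¬a<b ∘ <B⇒<R) (¬b<a ∘ <B⇒<R)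
    where
    go : ∀ v w → blockColour v ≡ 0 → ¬ v <B w → ¬ w <B v → blockColour w ≡ 0
    go (inD d) _       c≡0 _     _     = ⊥-elim (componentColour≢0 (x₀~? d) c≡0)
    go (inP _) (inD _) _   ¬v<w  _     = ⊥-elim (¬v<w tt)
    go (inQ _) (inD _) _   _     ¬w<v  = ⊥-elim (¬w<v tt)
    go _       (inP _) _   _     _     = refl
    go _       (inQ _) _   _     _     = refl

  comparable-same-colour : ∀ {a b} → a <R b → colour a ≢ 0 → colour b ≢ 0 → colour a ≡ colour b
  comparable-same-colour {a} {b} a<b = go (block a) (block b) (<R⇒<B a<b)
    where
    same : ∀ {d e} → d <D e → (D₁ : Dec (Star (Comparable _<D_) x₀ d)) (D₂ : Dec (Star (Comparable _<D_) x₀ e)) →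
           componentColour D₁ ≡ componentColour D₂
    same d<e (yes _)    (yes _)    = refl
    same d<e (yes x₀~d) (no x₀≁e)  = ⊥-elim (x₀≁e (x₀~d ◅◅ (inj₁ d<e ◅ ε)))
    same d<e (no x₀≁d)  (yes x₀~e) = ⊥-elim (x₀≁d (x₀~e ◅◅ (inj₂ d<e ◅ ε)))
    same d<e (no _)     (no _)     = refl
    go : ∀ v w → v <B w → blockColour v ≢ 0 → blockColour w ≢ 0 → blockColour v ≡ blockColour w
    go (inD d) (inD e) d<e _   _   = same d<e (x₀~? d) (x₀~? e)
    go (inD d) (inQ _) _   _   c≢0 = ⊥-elim (c≢0 refl)
    go (inP _) _       _   c≢0 _   = ⊥-elim (c≢0 refl)
    go (inQ _) _       _   c≢0 _   = ⊥-elim (c≢0 refl)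

  open ColourWords _<R_ _<R?_ colour p n' (m≤m+n (p + n) q) incomparable-to-uncoloured comparable-same-colour
    using (WindowColoured; InWindow; colourAt; colourAt-<; colourAt-≥; cactus-violated)

  colour-by-rank : ∀ z → (InWindow (rank z) → colour z ≢ 0) × (¬ InWindow (rank z) → colour z ≡ 0)
  colour-by-rank z = go (block z) refl
    where
    go : ∀ v → block z ≡ v → (InWindow (rank z) → blockColour v ≢ 0) × (¬ InWindow (rank z) → blockColour v ≡ 0)
    go (inP _) bz≡ = (λ inside → ⊥-elim (<⇒≱ below-p (proj₁ inside))) , (λ _ → refl)
      where
      below-p : rank z < p
      below-p = subst (rank z <_) count-levelBelow-1 (rank<count-levelBelow z (subst (λ v → level v < 1) (sym bz≡) z<s))
    go (inD d) bz≡ = (λ _ → componentColour≢0 (x₀~? d)) , (λ outside → ⊥-elim (outside (p≤ , <p+n)))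
      where
      p≤ : p ≤ rank z
      p≤ = subst (_≤ rank z) count-levelBelow-1 (count-levelBelow≤rank z (subst (λ v → 1 ≤ level v) (sym bz≡) (s≤s z≤n)))
      <p+n : rank z < p + n
      <p+n = subst (rank z <_) count-levelBelow-4
               (rank<count-levelBelow z (subst (λ v → level v < 4) (sym bz≡) (s≤s (s≤s (levelD≤2 d)))))
    go (inQ _) bz≡ = (λ inside → ⊥-elim (<⇒≱ (proj₂ inside) p+n≤)) , (λ _ → refl)
      where
      p+n≤ : p + n ≤ rank z
      p+n≤ = subst (_≤ rank z) count-levelBelow-4 (count-levelBelow≤rank z (subst (λ v → 4 ≤ level v) (sym bz≡) ≤-refl))

  word-windowColoured : WindowColoured word
  word-windowColoured y = by-range (y <? N)
    where
    by-range : Dec (y < N) → (InWindow y → colourAt word y ≢ 0) × (¬ InWindow y → colourAt word y ≡ 0)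
    by-range (no y≮N)  = (λ inside → ⊥-elim (y≮N (<-≤-trans (proj₂ inside) (m≤m+n (p + n) q))))
                       , (λ _ → colourAt-≥ word y≮N)
    by-range (yes y<N) = (λ inside → subst (_≢ 0) (sym colourAt≡) (proj₁ (colour-by-rank z) (subst InWindow (sym rank-z) inside)))
                       , (λ outside → trans colourAt≡ (proj₂ (colour-by-rank z) (outside ∘ subst InWindow rank-z)))
      where
      z : Fin N
      z = word (fromℕ< y<N)
      rank-z : rank z ≡ y
      rank-z = trans (rank-word (fromℕ< y<N)) (toℕ-fromℕ< y<N)
      colourAt≡ : colourAt word y ≡ colour z
      colourAt≡ = colourAt-< word y<N

  colourAt-rank : ∀ {z y} (y<N : y < N) → rank z ≡ y → colourAt word y ≡ colour z
  colourAt-rank {z} y<N rz≡y = trans (colourAt-< word y<N) (cong colour (word-at-rank y<N rz≡y))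

  colours-differ : 1 ≤ n' → colourAt word (p + 0) ≢ colourAt word (p + 1)
  colours-differ 1≤n' same = 1≢2 (begin
      1                            ≡⟨ sym (colour-at x₀ λ { (yes _) → refl ; (no x₀≁x₀) → ⊥-elim (x₀≁x₀ ε) }) ⟩
      colour x₀*                   ≡⟨ sym (colourAt-rank p+0<N (trans rank-x₀* (sym (+-identityʳ p)))) ⟩
      colourAt word (p + 0)        ≡⟨ same ⟩
      colourAt word (p + 1)        ≡⟨ colourAt-rank p+1<N rank-y₀* ⟩
      colour y₀*                   ≡⟨ colour-at y₀ (λ { (yes x₀~y₀) → ⊥-elim (x₀≁y₀ x₀~y₀) ; (no _) → refl }) ⟩
      2                            ∎)
    where
    1≢2 : 1 ≢ 2
    1≢2 ()
    colour-at : ∀ d {c} → (∀ (x₀~d? : Dec (Star (Comparable _<D_) x₀ d)) → componentColour x₀~d? ≡ c) →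
                colour (embed (inD d)) ≡ c
    colour-at d value = trans (cong blockColour (block-embed (inD d))) (value (x₀~? d))
    p+0<N : p + 0 < N
    p+0<N = <-≤-trans (+-monoʳ-< p z<s) (m≤m+n (p + n) q)
    p+1<N : p + 1 < N
    p+1<N = <-≤-trans (+-monoʳ-< p (s≤s 1≤n')) (m≤m+n (p + n) q)

  not-LECactus : 2 ≤ n' → Obstruction p n q → ¬ LECactus _<R_ _<R?_
  not-LECactus 2≤n' (δ , s , δ∈ , p+3≤A , p+A<N) cactus =
    cactus-violated 2≤n' s δ∈ word word-windowColoured (colours-differ (≤-trans (s≤s z≤n) 2≤n'))
      (cactus (suc p) A (suc (p + A)) (s≤s z≤n) i+1<j (s≤s (m≤n+m A p)) p+A<N word (word-bijective , word-monotone))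
    where
    A : ℕ
    A = δ + suc s * n
    i+1<j : suc p + 1 < A
    i+1<j = subst (_≤ A) (trans (+-suc p 2) (cong suc (+-suc p 1))) p+3≤A

-- Connectedness of D is not decidable here, so the minimal elements in distinct
-- components and the test for the component of x₀ are obtained under a double
-- negation; this is harmless because the goal is ⊥.
disconnected-not-LECactus :
  ∀ {p n' q} {_<P_ : Rel (Fin p) 0ℓ} {_<D_ : Rel (Fin (suc n')) 0ℓ} {_<Q_ : Rel (Fin q) 0ℓ} →
  IsStrictPartialOrder _≡_ _<P_ → IsStrictPartialOrder _≡_ _<D_ → IsStrictPartialOrder _≡_ _<Q_ →
  (dP : Decidable _<P_) (dD : Decidable _<D_) (dQ : Decidable _<Q_) → Disconnected _<D_ →
  2 ≤ n' → Obstruction p (suc n') q → ¬ LECactus (ordRel (ordRel _<P_ _<D_) _<Q_) (ordDec (ordDec dP dD) dQ)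
disconnected-not-LECactus {_<D_ = _<D_} sP sD sQ dP dD dQ disconnected 2≤n' obstruction cactus =
  ¬¬-∀-Fin (λ x → ¬¬-∀-Fin (connected x)) disconnected
  where
  open Height sD dD using (minimal-below)
  connected : ∀ x y → ¬ ¬ Star (Comparable _<D_) x y
  connected x y x≁y with minimal-below x | minimal-below y
  ... | x₀ , x₀~x , x₀-minimal | y₀ , y₀~y , y₀-minimal =
    ¬¬-∀-Fin (λ _ → ¬¬-excluded-middle) λ x₀~? →
      MinimaFirstExtension.not-LECactus sP sD sQ dP dD dQ x₀ y₀ x₀-minimal y₀-minimal x₀~? x₀≁y₀ 2≤n' obstruction cactus
    where
    x₀≁y₀ : ¬ Star (Comparable _<D_) x₀ y₀
    x₀≁y₀ x₀~y₀ = x≁y (reverse swap x₀~x ◅◅ x₀~y₀ ◅◅ y₀~y)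

-- The numerical conditions

mod1-quotient : ∀ q n' → ∃[ k ] q + suc n' ≡ mod1 q (suc n') + k * suc n'
mod1-quotient q n' with q % suc n' | m≡m%n+[m/n]*n q (suc n')
... | zero  | q≡ = q / suc n' , trans (cong (_+ suc n') q≡) (+-comm (q / suc n' * suc n') (suc n'))
... | suc r | q≡ = suc (q / suc n') , trans (cong (_+ suc n') q≡) (shuffle r (q / suc n' * suc n') n')
  where
  shuffle : ∀ a b c → suc a + b + suc c ≡ suc a + (suc c + b)
  shuffle = solve-∀

mod1-range : ∀ q n' → 1 ≤ mod1 q (suc n') × mod1 q (suc n') ≤ suc n'
mod1-range q n' with q % suc n' | m%n<n q (suc n')
... | zero  | _   = s≤s z≤n , ≤-refl
... | suc r | r<n = s≤s z≤n , <⇒≤ r<n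

choose-δ : ∀ {r d} → 1 ≤ r → (d ≡ 4 × (r ≡ 1 ⊎ r ≡ 3)) ⊎ (5 ≤ d × r < d) →
           ∃[ δ ] (δ ≡ 0 ⊎ δ ≡ 2) × δ < r × r + 3 ≤ δ + d
choose-δ _   (inj₁ (refl , inj₁ refl)) = 0 , inj₁ refl , s≤s z≤n , ≤-refl
choose-δ _   (inj₁ (refl , inj₂ refl)) = 2 , inj₂ refl , ≤-refl , ≤-refl
choose-δ {r} {d} 1≤r (inj₂ (5≤d , r<d)) with r + 3 ≤? d
... | yes r+3≤d = 0 , inj₁ refl , 1≤r , r+3≤d
... | no  r+3≰d = 2 , inj₂ refl , 2<r , subst (_≤ 2 + d) (shuffle r) (+-monoʳ-≤ 2 r<d′)
  where
  shuffle : ∀ r → 2 + (r + 1) ≡ r + 3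
  shuffle = solve-∀
  d≤r+2 : d ≤ r + 2
  d≤r+2 = s≤s⁻¹ (≤-trans (≰⇒> r+3≰d) (≤-reflexive (+-suc r 2)))
  2<r : 2 < r
  2<r = +-cancelʳ-≤ 2 3 r (≤-trans 5≤d d≤r+2)
  r<d′ : r + 1 ≤ d
  r<d′ = subst (_≤ d) (+-comm 1 r) r<d

obstruction-from-residue : ∀ {p n q} r k {d δ} → q + n ≡ r + k * n → p + d ≡ q + n →
              (δ ≡ 0 ⊎ δ ≡ 2) → δ < r → r + 3 ≤ δ + d → Obstruction p n q
obstruction-from-residue {p} {n} {q} r zero {d} {δ} q+n≡ p+d≡ δ∈ δ<r r+3≤ = ⊥-elim (<⇒≱ (δ<3 δ∈) 3≤δ)
  where
  d≤r : d ≤ r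
  d≤r = ≤-trans (m≤n+m d p) (≤-reflexive (trans p+d≡ (trans q+n≡ (+-identityʳ r))))
  3≤δ : 3 ≤ δ
  3≤δ = +-cancelˡ-≤ r 3 δ (≤-trans r+3≤ (≤-trans (+-monoʳ-≤ δ d≤r) (≤-reflexive (+-comm δ r))))
  δ<3 : ∀ {δ} → δ ≡ 0 ⊎ δ ≡ 2 → δ < 3
  δ<3 (inj₁ refl) = s≤s z≤n
  δ<3 (inj₂ refl) = ≤-refl
obstruction-from-residue {p} {n} {q} r (suc s) {d} {δ} q+n≡ p+d≡ δ∈ δ<r r+3≤ = δ , s , δ∈ , p+3≤A , p+A<N
  where
  open ≤-Reasoning
  A : ℕ
  A = δ + suc s * n
  p+3≤A : p + 3 ≤ A
  p+3≤A = +-cancelˡ-≤ r (p + 3) A (begin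
    r + (p + 3)          ≡⟨ shuffle r p ⟩
    p + (r + 3)          ≤⟨ +-monoʳ-≤ p r+3≤ ⟩
    p + (δ + d)          ≡⟨ shuffle′ p δ d ⟩
    δ + (p + d)          ≡⟨ cong (δ +_) (trans p+d≡ q+n≡) ⟩
    δ + (r + suc s * n)  ≡⟨ shuffle′ δ r (suc s * n) ⟩
    r + A                ∎)
    where
    shuffle : ∀ r p → r + (p + 3) ≡ p + (r + 3)
    shuffle = solve-∀
    shuffle′ : ∀ a b c → a + (b + c) ≡ b + (a + c)
    shuffle′ = solve-∀
  p+A<N : p + A < p + n + q
  p+A<N = begin-strict
    p + A                <⟨ +-monoʳ-< p (+-monoˡ-< (suc s * n) δ<r) ⟩
    p + (r + suc s * n)  ≡⟨ cong (p +_) (sym q+n≡) ⟩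
    p + (q + n)          ≡⟨ cong (p +_) (+-comm q n) ⟩
    p + (n + q)          ≡⟨ sym (+-assoc p n q) ⟩
    p + n + q            ∎

no-obstruction-bound : ∀ {p n' q} → ¬ Obstruction p (suc n') q → p + 4 ≤ q + suc n' →
  (p + 4 ≡ q + suc n' × mod1 q (suc n') ≢ 1 × mod1 q (suc n') ≢ 3)
  ⊎ (∃[ d ] 4 < d × p + d ≡ q + suc n' × d ∸ 1 < mod1 q (suc n'))
no-obstruction-bound {p} {n'} {q} ¬obstruction p+4≤q+n = by-gap (d ≟ 4) (d ∸ 1 <? r)
  where
  n r d : ℕ
  n = suc n'
  r = mod1 q n
  d = q + n ∸ p
  p+d≡q+n : p + d ≡ q + n
  p+d≡q+n = m+[n∸m]≡n (≤-trans (m≤m+n p 4) p+4≤q+n)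
  4≤d : 4 ≤ d
  4≤d = +-cancelˡ-≤ p 4 d (≤-trans p+4≤q+n (≤-reflexive (sym p+d≡q+n)))
  excluded : (d ≡ 4 × (r ≡ 1 ⊎ r ≡ 3)) ⊎ (5 ≤ d × r < d) → ⊥
  excluded gap with mod1-quotient q n' | choose-δ (proj₁ (mod1-range q n')) gap
  ... | k , q+n≡ | δ , δ∈ , δ<r , r+3≤δ+d = ¬obstruction (obstruction-from-residue r k q+n≡ p+d≡q+n δ∈ δ<r r+3≤δ+d)
  by-gap : Dec (d ≡ 4) → Dec (d ∸ 1 < r) →
           (p + 4 ≡ q + n × r ≢ 1 × r ≢ 3) ⊎ (∃[ d ] 4 < d × p + d ≡ q + n × d ∸ 1 < r)
  by-gap (yes d≡4) _ = inj₁ ( trans (cong (p +_) (sym d≡4)) p+d≡q+n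
                            , (λ r≡1 → excluded (inj₁ (d≡4 , inj₁ r≡1)))
                            , (λ r≡3 → excluded (inj₁ (d≡4 , inj₂ r≡3))))
  by-gap (no d≢4) (yes d∸1<r) = inj₂ (d , ≤∧≢⇒< 4≤d (d≢4 ∘ sym) , p+d≡q+n , d∸1<r)
  by-gap (no d≢4) (no d∸1≮r)  = ⊥-elim (excluded (inj₂ (≤∧≢⇒< 4≤d (d≢4 ∘ sym) , r<d)))
    where
    r<d : r < d
    r<d = subst (r <_) (trans (+-comm 1 (d ∸ 1)) (m∸n+n≡m (≤-trans (s≤s z≤n) 4≤d))) (s≤s (≮⇒≥ d∸1≮r))

cactus-bound-large : ∀ {p n q} → 3 < n → ¬ Obstruction p n q →
  (q + n ∸ 4 < p)
  ⊎ (p ≡ q + n ∸ 4 × mod1 q n ≢ 1 × mod1 q n ≢ 3)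
  ⊎ (∃[ r ] (4 < r × p + r ≡ q + n × r ∸ 1 < mod1 q n))
cactus-bound-large {p} {suc n'} {q} 3<n ¬obstruction with q + suc n' ∸ 4 <? p
... | yes below = inj₁ below
... | no ¬below = inj₂ (Sum.map₁ (Product.map₁ solve-for-p) (no-obstruction-bound ¬obstruction p+4≤q+n))
  where
  p+4≤q+n : p + 4 ≤ q + suc n'
  p+4≤q+n = ≤-trans (+-monoˡ-≤ 4 (≮⇒≥ ¬below)) (≤-reflexive (m∸n+n≡m (≤-trans 3<n (m≤n+m (suc n') q))))
  solve-for-p : p + 4 ≡ q + suc n' → p ≡ q + suc n' ∸ 4
  solve-for-p p+4≡q+n = trans (sym (m+n∸n≡m p 4)) (cong (_∸ 4) p+4≡q+n)

cactus-bound-three : ∀ {p q} → ¬ Obstruction p 3 q → (q < p + 1) ⊎ (p + 1 ≡ q × mod1 q 3 ≢ 1 × mod1 q 3 ≢ 3)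
cactus-bound-three {p} {q} ¬obstruction with q <? p + 1
... | yes below = inj₁ below
... | no ¬below = [ inj₂ ∘ Product.map₁ solve-for-q , ⊥-elim ∘ gap-too-large ] (no-obstruction-bound ¬obstruction p+4≤q+3)
  where
  p+4≤q+3 : p + 4 ≤ q + 3
  p+4≤q+3 = ≤-trans (≤-reflexive (sym (+-assoc p 1 3))) (+-monoˡ-≤ 3 (≮⇒≥ ¬below))
  solve-for-q : p + 4 ≡ q + 3 → p + 1 ≡ q
  solve-for-q p+4≡q+3 = +-cancelʳ-≡ 3 (p + 1) q (trans (+-assoc p 1 3) p+4≡q+3)
  gap-too-large : ¬ (∃[ d ] 4 < d × p + d ≡ q + 3 × d ∸ 1 < mod1 q 3)
  gap-too-large (d , 4<d , _ , d∸1<r) =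
    <⇒≱ (<-≤-trans d∸1<r (proj₂ (mod1-range q 2))) (≤-trans (n≤1+n 3) (∸-monoˡ-≤ 1 4<d))

proposition5p1 : ∀ {p n q : ℕ}
    (_<P_ : Rel (Fin p) 0ℓ) (_<D_ : Rel (Fin n) 0ℓ) (_<Q_ : Rel (Fin q) 0ℓ) →
    IsStrictPartialOrder _≡_ _<P_ → IsStrictPartialOrder _≡_ _<D_ → IsStrictPartialOrder _≡_ _<Q_ →
    (dP : Decidable _<P_) (dD : Decidable _<D_) (dQ : Decidable _<Q_) →
    Disconnected _<D_ →
    LECactus (ordRel (ordRel _<P_ _<D_) _<Q_) (ordDec (ordDec dP dD) dQ) →
    (3 < n →
      (q + n ∸ 4 < p)
      ⊎ (p ≡ q + n ∸ 4 × mod1 q n ≢ 1 × mod1 q n ≢ 3)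
      ⊎ (∃[ r ] (4 < r × p + r ≡ q + n × r ∸ 1 < mod1 q n)))
    × (n ≡ 3 →
      (q < p + 1)
      ⊎ (p + 1 ≡ q × mod1 q 3 ≢ 1 × mod1 q 3 ≢ 3))
proposition5p1 {n = zero} _ _ _ _ _ _ _ _ _ _ _ = (λ ()) , (λ ())
proposition5p1 {p} {suc n'} {q} _ _ _ sP sD sQ dP dD dQ disconnected cactus =
    (λ 3<n → cactus-bound-large 3<n (no-obstruction (<⇒≤ (s≤s⁻¹ 3<n))))
  , (λ { refl → cactus-bound-three (no-obstruction ≤-refl) })
  where
  no-obstruction : 2 ≤ n' → ¬ Obstruction p (suc n') q
  no-obstruction 2≤n' obstruction = disconnected-not-LECactus sP sD sQ dP dD dQ disconnected 2≤n' obstruction cactus
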